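{- Let $\alpha>1$ be an integer and let $a$ be any integer such that \[ a>-\frac{\alpha^{2/3}}{1+\alpha^{1/3}}. \] For $n\ge 0$ set \[ a_n=\sum_{\substack{i,j\ge 0\\ 2i+3j\le n}}(-1)^i\binom{i+j}{j}\binom{n-i-2j}{i+j}(3a)^{n-2i-3j}(3a^{2}-3\alpha)^i\,(a^3+\alpha-3a\alpha+\alpha^{2})^j . \] Then \[ \lim_{n\to\infty}\left(1+\frac{\alpha-1}{\dfrac{a_n}{a_{n-1}}-a+1}\right)=\alpha^{1/3}. \] -}

module Defs where

open import Data.Nat as ℕ using (ℕ; zero; suc; _≤ᵇ_)
open import Data.Nat.Combinatorics using (_C_)
open import Data.Integer as ℤ using (ℤ; +_; -_)
open import Data.Rational as ℚ using (ℚ; _÷_; ≢-nonZero)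
open import Data.Bool using (if_then_else_)
open import Data.List using (List; upTo; map; foldr)
open import Relation.Binary.PropositionalEquality using (_≢_)

fromℤ : ℤ → ℚ
fromℤ z = z ℚ./ 1

sumℤ≤ : ℕ → (ℕ → ℤ) → ℤ
sumℤ≤ n f = foldr ℤ._+_ (+ 0) (map f (upTo (suc n)))

-- summand of a_n (only used when 2i+3j ≤ n)
term : ℤ → ℤ → ℕ → ℕ → ℕ → ℤ
term α a n i j =
  ((- + 1) ℤ.^ i) ℤ.* (+ ((i ℕ.+ j) C j)) ℤ.* (+ ((n ℕ.∸ i ℕ.∸ 2 ℕ.* j) C (i ℕ.+ j)))
  ℤ.* ((+ 3 ℤ.* a) ℤ.^ (n ℕ.∸ 2 ℕ.* i ℕ.∸ 3 ℕ.* j))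
  ℤ.* ((+ 3 ℤ.* a ℤ.* a ℤ.- + 3 ℤ.* α) ℤ.^ i)
  ℤ.* ((a ℤ.* a ℤ.* a ℤ.+ α ℤ.- + 3 ℤ.* a ℤ.* α ℤ.+ α ℤ.* α) ℤ.^ j)

aseq : ℤ → ℤ → ℕ → ℤ
aseq α a n = sumℤ≤ n λ i → sumℤ≤ n λ j →
  if 2 ℕ.* i ℕ.+ 3 ℕ.* j ≤ᵇ n then term α a n i j else + 0

ratio : (α a : ℤ) (n : ℕ) → fromℤ (aseq α a n) ≢ ℚ.0ℚ → ℚ
ratio α a n h = fromℤ (aseq α a (suc n)) ÷ fromℤ (aseq α a n)
  where instance _ = ≢-nonZero h

denom : (α a : ℤ) (n : ℕ) → fromℤ (aseq α a n) ≢ ℚ.0ℚ → ℚ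
denom α a n h = ratio α a n h ℚ.- fromℤ a ℚ.+ ℚ.1ℚ

-- x_{n+1} = 1 + (α - 1) / (a_{n+1}/a_n - a + 1)
xseq : (α a : ℤ) (n : ℕ) (h₁ : fromℤ (aseq α a n) ≢ ℚ.0ℚ) → denom α a n h₁ ≢ ℚ.0ℚ → ℚ
xseq α a n h₁ h₂ = ℚ.1ℚ ℚ.+ (fromℤ α ℚ.- ℚ.1ℚ) ÷ denom α a n h₁
  where instance _ = ≢-nonZero h₂

cube : ℚ → ℚ
cube x = x ℚ.* x ℚ.* x

-- "a > -α^{2/3}/(1+α^{1/3})" for the real cube root α^{1/3}, expressed via
-- rational approximations from below: since t ↦ t²/(1+t) is increasing on t > 0,
-- it holds iff some rational 0 < q with q³ < α satisfies -q²/(1+q) < a,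
-- i.e. -(q·q) < a·(1+q).
LowerBound : ℤ → ℤ → Set
LowerBound α a = Data.Product.Σ ℚ λ q →
  (ℚ.0ℚ ℚ.< q) Data.Product.× (cube q ℚ.< fromℤ α) Data.Product.×
  (ℚ.- (q ℚ.* q) ℚ.< fromℤ a ℚ.* (ℚ.1ℚ ℚ.+ q))
  where import Data.Product

-- "x_{n} → α^{1/3}": for every rational ε > 0, eventually the terms are defined and
-- |x_n - α^{1/3}| < ε, i.e. (x_n - ε)³ < α < (x_n + ε)³ (cube is strictly increasing).
ConvergesToCbrt : ℤ → ℤ → Set
ConvergesToCbrt α a = ∀ (ε : ℚ) → ℚ.0ℚ ℚ.< ε → Σ ℕ λ N → ∀ n → N ℕ.≤ n →
  Σ (fromℤ (aseq α a n) ≢ ℚ.0ℚ) λ h₁ → Σ (denom α a n h₁ ≢ ℚ.0ℚ) λ h₂ →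
    (cube (xseq α a n h₁ h₂ ℚ.- ε) ℚ.< fromℤ α) × (fromℤ α ℚ.< cube (xseq α a n h₁ h₂ ℚ.+ ε))
  where open import Data.Product using (Σ; _×_)

-- Let u = a + t + t² in ℚ[t]/(t³ − α). The sum defining aₙ is the trinomial expansion of the n-th
-- coefficient of 1/(1 − e₁x + e₂x² − e₃x³), where e₁, e₂, e₃ are the elementary symmetric functions
-- of the conjugates a + ωᵏ∛α + ω²ᵏ∛α² of u. So (aₙ) obeys the linear recurrence given by the minimal
-- polynomial of u, and comparing initial values gives (α − 1) aₙ = c₁ − c₂ where
-- c₀ + c₁t + c₂t² = u^(n+2); since u^(n+3) = u · u^(n+2), the n-th term of the sequence is c₁/c₂.
-- The hypothesis on a says exactly that the real conjugate of u exceeds the other two in absolute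
-- value, so u^m tends to an eigenvector of multiplication by t and c₁/c₂ → ∛α.
-- To stay inside ℚ this is first shown for t³ = s³ with s rational, uniformly for s in a compact
-- interval: there evaluation at s is a ring homomorphism and the norm is the real conjugate times a
-- sum of squares. For fixed m the coordinates of u^m are Lipschitz in b, which transfers the estimate
-- to b = α from rational s on either side of ∛α with s³ close enough to α, found by bisection.

module Submission where

open import Defs
open import Level using (0ℓ)
open import Data.Nat as ℕ using (ℕ; zero; suc)
import Data.Nat.Properties as ℕ
open import Data.Product using (Σ; _×_; _,_; proj₁; proj₂)
open import Data.Sum using (_⊎_; inj₁; inj₂)
open import Data.Unit using (tt)
open import Relation.Binary.PropositionalEquality
open import Relation.Nullary using (yes; no)
open import Relation.Nullary.Decidable using (dec⇒maybe; toWitness)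

module Recurrence where
  open import Function using (_∘_)
  open import Data.Bool using (true; false; if_then_else_)
  open import Data.Nat using (_≤ᵇ_)
  open import Relation.Nullary using (contradiction)
  open import Data.Nat.Combinatorics using (_C_; nCn≡1; nCk+nC[k+1]≡[n+1]C[k+1])
  open import Data.Nat.Tactic.RingSolver using () renaming (solve-∀ to ℕ-solve-∀)
  open import Data.Integer using (ℤ; +_; -_; _+_; _-_; _*_; _^_)
  import Data.Integer.Properties as ℤ
  open import Data.Integer.Tactic.RingSolver using (solve-∀)
  open import Data.List using (foldr; applyUpTo; upTo)
  open import Data.List.Properties using (map-upTo; map-cong)
  open import Relation.Nullary.Reflects using (ofʸ; ofⁿ)
  open ≡-Reasoning

  sumℤ≤-applyUpTo : ∀ n f → sumℤ≤ n f ≡ foldr _+_ (+ 0) (applyUpTo f (suc n))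
  sumℤ≤-applyUpTo n f = cong (foldr _+_ (+ 0)) (map-upTo f (suc n))

  sumℤ≤-suc : ∀ n f → sumℤ≤ (suc n) f ≡ f 0 + sumℤ≤ n (f ∘ suc)
  sumℤ≤-suc n f =
    trans (sumℤ≤-applyUpTo (suc n) f) (cong (_+_ (f 0)) (sym (sumℤ≤-applyUpTo n (f ∘ suc))))

  sumℤ≤-cong : ∀ n {f g : ℕ → ℤ} → (∀ i → f i ≡ g i) → sumℤ≤ n f ≡ sumℤ≤ n g
  sumℤ≤-cong n f≗g = cong (foldr _+_ (+ 0)) (map-cong f≗g (upTo (suc n)))

  sumℤ≤-zero : ∀ n {f : ℕ → ℤ} → (∀ i → f i ≡ + 0) → sumℤ≤ n f ≡ + 0
  sumℤ≤-zero zero    f≗0 = cong (_+ + 0) (f≗0 0)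
  sumℤ≤-zero (suc n) {f} f≗0 = begin
    sumℤ≤ (suc n) f              ≡⟨ sumℤ≤-suc n f ⟩
    f 0 + sumℤ≤ n (f ∘ suc)      ≡⟨ cong₂ _+_ (f≗0 0) (sumℤ≤-zero n (f≗0 ∘ suc)) ⟩
    + 0                          ∎

  sumℤ≤-linear : ∀ n (x y z : ℤ) (f g h : ℕ → ℤ) →
    sumℤ≤ n (λ i → x * f i + y * g i + z * h i) ≡ x * sumℤ≤ n f + y * sumℤ≤ n g + z * sumℤ≤ n h
  sumℤ≤-linear zero x y z f g h = base x y z (f 0) (g 0) (h 0)
    where
    base : ∀ x y z u v w → x * u + y * v + z * w + + 0 ≡ x * (u + + 0) + y * (v + + 0) + z * (w + + 0)
    base = solve-∀
  sumℤ≤-linear (suc n) x y z f g h = begin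
    sumℤ≤ (suc n) (λ i → x * f i + y * g i + z * h i)
      ≡⟨ sumℤ≤-suc n (λ i → x * f i + y * g i + z * h i) ⟩
    x * f 0 + y * g 0 + z * h 0 + sumℤ≤ n (λ i → x * f (suc i) + y * g (suc i) + z * h (suc i))
      ≡⟨ cong (_+_ (x * f 0 + y * g 0 + z * h 0))
              (sumℤ≤-linear n x y z (f ∘ suc) (g ∘ suc) (h ∘ suc)) ⟩
    x * f 0 + y * g 0 + z * h 0 + (x * F + y * G + z * H)
      ≡⟨ step x y z (f 0) (g 0) (h 0) F G H ⟩
    x * (f 0 + F) + y * (g 0 + G) + z * (h 0 + H)
      ≡⟨ sym (cong₂ (λ u v → x * u + y * v + z * (h 0 + H)) (sumℤ≤-suc n f) (sumℤ≤-suc n g)) ⟩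
    x * sumℤ≤ (suc n) f + y * sumℤ≤ (suc n) g + z * (h 0 + H)
      ≡⟨ sym (cong (λ w → x * sumℤ≤ (suc n) f + y * sumℤ≤ (suc n) g + z * w) (sumℤ≤-suc n h)) ⟩
    x * sumℤ≤ (suc n) f + y * sumℤ≤ (suc n) g + z * sumℤ≤ (suc n) h ∎
    where
    F = sumℤ≤ n (f ∘ suc)
    G = sumℤ≤ n (g ∘ suc)
    H = sumℤ≤ n (h ∘ suc)
    step : ∀ x y z u v w U V W →
      x * u + y * v + z * w + (x * U + y * V + z * W) ≡ x * (u + U) + y * (v + V) + z * (w + W)
    step = solve-∀

  sumℤ≤-extend : ∀ {n K} {f : ℕ → ℤ} → (∀ i → n ℕ.< i → f i ≡ + 0) → n ℕ.≤ K →
    sumℤ≤ K f ≡ sumℤ≤ n f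
  sumℤ≤-extend {zero} {zero} f-vanish _ = refl
  sumℤ≤-extend {zero} {suc K} {f} f-vanish _ = begin
    sumℤ≤ (suc K) f            ≡⟨ sumℤ≤-suc K f ⟩
    f 0 + sumℤ≤ K (f ∘ suc)    ≡⟨ cong (_+_ (f 0)) (sumℤ≤-zero K λ i → f-vanish (suc i) (ℕ.s≤s ℕ.z≤n)) ⟩
    f 0 + + 0                  ∎
  sumℤ≤-extend {suc n} {suc K} {f} f-vanish (ℕ.s≤s n≤K) = begin
    sumℤ≤ (suc K) f            ≡⟨ sumℤ≤-suc K f ⟩
    f 0 + sumℤ≤ K (f ∘ suc)    ≡⟨ cong (_+_ (f 0)) (sumℤ≤-extend (λ i → f-vanish (suc i) ∘ ℕ.s≤s) n≤K) ⟩
    f 0 + sumℤ≤ n (f ∘ suc)    ≡⟨ sym (sumℤ≤-suc n f) ⟩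
    sumℤ≤ (suc n) f            ∎


  shift : (ℕ → ℤ) → ℕ → ℤ
  shift f zero    = + 0
  shift f (suc k) = f k

  binomial : ℕ → ℕ → ℕ
  binomial i j = (i ℕ.+ j) C j

  binomial-pascal : ∀ i j → binomial (suc i) (suc j) ≡ binomial i (suc j) ℕ.+ binomial (suc i) j
  binomial-pascal i j = begin
    (suc i ℕ.+ suc j) C suc j                    ≡⟨ sym (nCk+nC[k+1]≡[n+1]C[k+1] (i ℕ.+ suc j) j) ⟩
    (i ℕ.+ suc j) C j ℕ.+ (i ℕ.+ suc j) C suc j  ≡⟨ cong (λ m → m C j ℕ.+ (i ℕ.+ suc j) C suc j) (ℕ.+-suc i j) ⟩
    (suc i ℕ.+ j) C j ℕ.+ (i ℕ.+ suc j) C suc j  ≡⟨ ℕ.+-comm ((suc i ℕ.+ j) C j) _ ⟩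
    binomial i (suc j) ℕ.+ binomial (suc i) j    ∎

  shift-*ˡ : ∀ c f k → c * shift f k ≡ shift (λ k′ → c * f k′) k
  shift-*ˡ c f zero    = ℤ.*-zeroʳ c
  shift-*ˡ c f (suc k) = refl

  weighted : ℤ → ℤ → ℕ → ℕ → ℤ
  weighted x y i j = + binomial i j * x ^ i * y ^ j

  weighted-pascal : ∀ x y i j → 0 ℕ.< i ℕ.+ j →
    weighted x y i j ≡ x * shift (λ i′ → weighted x y i′ j) i + y * shift (weighted x y i) j
  weighted-pascal x y (suc i) zero _ = ring x y (x ^ i)
    where
    ring : ∀ x y X → + 1 * (x * X) * + 1 ≡ x * (+ 1 * X * + 1) + y * + 0
    ring = solve-∀
  weighted-pascal x y zero (suc j) _ = begin
    + binomial 0 (suc j) * + 1 * (y * y ^ j)     ≡⟨ cong (λ b → + b * + 1 * (y * y ^ j)) (nCn≡1 (suc j)) ⟩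
    + 1 * + 1 * (y * y ^ j)                      ≡⟨ ring x y (y ^ j) ⟩
    x * + 0 + y * (+ 1 * + 1 * y ^ j)            ≡⟨ cong (λ b → x * + 0 + y * (+ b * + 1 * y ^ j)) (sym (nCn≡1 j)) ⟩
    x * + 0 + y * (+ binomial 0 j * + 1 * y ^ j) ∎
    where
    ring : ∀ x y Y → + 1 * + 1 * (y * Y) ≡ x * + 0 + y * (+ 1 * + 1 * Y)
    ring = solve-∀
  weighted-pascal x y (suc i) (suc j) _ = begin
    + binomial (suc i) (suc j) * (x * x ^ i) * (y * y ^ j)
      ≡⟨ cong (λ b → b * (x * x ^ i) * (y * y ^ j))
           (trans (cong +_ (binomial-pascal i j)) (ℤ.pos-+ (binomial i (suc j)) (binomial (suc i) j))) ⟩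
    (+ binomial i (suc j) + + binomial (suc i) j) * (x * x ^ i) * (y * y ^ j)
      ≡⟨ ring x y (x ^ i) (y ^ j) (+ binomial i (suc j)) (+ binomial (suc i) j) ⟩
    x * (+ binomial i (suc j) * x ^ i * (y * y ^ j)) + y * (+ binomial (suc i) j * (x * x ^ i) * y ^ j) ∎
    where
    ring : ∀ x y X Y b c → (b + c) * (x * X) * (y * Y) ≡ x * (b * X * (y * Y)) + y * (c * (x * X) * Y)
    ring = solve-∀

  [-1]^i*x^i≡[-x]^i : ∀ x i → (- + 1) ^ i * x ^ i ≡ (- x) ^ i
  [-1]^i*x^i≡[-x]^i x zero    = refl
  [-1]^i*x^i≡[-x]^i x (suc i) = trans (ring x ((- + 1) ^ i) (x ^ i)) (cong (- x *_) ([-1]^i*x^i≡[-x]^i x i))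
    where
    ring : ∀ x s X → (- + 1 * s) * (x * X) ≡ - x * (s * X)
    ring = solve-∀

  if-≤ᵇ-true : ∀ {m n} {x y : ℤ} → m ℕ.≤ n → (if m ≤ᵇ n then x else y) ≡ x
  if-≤ᵇ-true {m} {n} m≤n with m ≤ᵇ n | ℕ.≤ᵇ-reflects-≤ m n
  ... | true  | _        = refl
  ... | false | ofⁿ m≰n = contradiction m≤n m≰n

  if-≤ᵇ-false : ∀ {m n} {x y : ℤ} → n ℕ.< m → (if m ≤ᵇ n then x else y) ≡ y
  if-≤ᵇ-false {m} {n} n<m with m ≤ᵇ n | ℕ.≤ᵇ-reflects-≤ m n
  ... | false | _        = refl
  ... | true  | ofʸ m≤n = contradiction m≤n (ℕ.<⇒≱ n<m)

  rectangle : ℕ → ℕ → (ℕ → ℕ → ℤ) → ℤ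
  rectangle I J F = sumℤ≤ I λ i → sumℤ≤ J λ j → F i j

  rectangle-cong : ∀ I J {F G : ℕ → ℕ → ℤ} → (∀ i j → F i j ≡ G i j) →
    rectangle I J F ≡ rectangle I J G
  rectangle-cong I J F≗G = sumℤ≤-cong I (λ i → sumℤ≤-cong J (F≗G i))

  rectangle-linear : ∀ I J (x y z : ℤ) (F G H : ℕ → ℕ → ℤ) →
    rectangle I J (λ i j → x * F i j + y * G i j + z * H i j)
      ≡ x * rectangle I J F + y * rectangle I J G + z * rectangle I J H
  rectangle-linear I J x y z F G H =
    trans (sumℤ≤-cong I (λ i → sumℤ≤-linear J x y z (F i) (G i) (H i)))
          (sumℤ≤-linear I x y z (sumℤ≤ J ∘ F) (sumℤ≤ J ∘ G) (sumℤ≤ J ∘ H))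

  rectangle-zero : ∀ I J {F : ℕ → ℕ → ℤ} → (∀ i j → F i j ≡ + 0) → rectangle I J F ≡ + 0
  rectangle-zero I J F≗0 = sumℤ≤-zero I (λ i → sumℤ≤-zero J (F≗0 i))

  rectangle-extend : ∀ {n I J} {F : ℕ → ℕ → ℤ} →
    (∀ i j → n ℕ.< i ⊎ n ℕ.< j → F i j ≡ + 0) → n ℕ.≤ I → n ℕ.≤ J →
    rectangle I J F ≡ rectangle n n F
  rectangle-extend {n} {I} {J} F-vanish n≤I n≤J =
    trans (sumℤ≤-cong I (λ i → sumℤ≤-extend (λ j n<j → F-vanish i j (inj₂ n<j)) n≤J))
          (sumℤ≤-extend (λ i n<i → sumℤ≤-zero n (λ j → F-vanish i j (inj₁ n<i))) n≤I)

  rectangle-shiftˡ : ∀ I J (F : ℕ → ℕ → ℤ) →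
    rectangle (suc I) J (λ i j → shift (λ i′ → F i′ j) i) ≡ rectangle I J F
  rectangle-shiftˡ I J F = begin
    rectangle (suc I) J (λ i j → shift (λ i′ → F i′ j) i)
      ≡⟨ sumℤ≤-suc I (λ i → sumℤ≤ J (λ j → shift (λ i′ → F i′ j) i)) ⟩
    sumℤ≤ J (λ _ → + 0) + rectangle I J F
      ≡⟨ cong (_+ rectangle I J F) (sumℤ≤-zero J (λ _ → refl)) ⟩
    + 0 + rectangle I J F
      ≡⟨ ℤ.+-identityˡ _ ⟩
    rectangle I J F ∎

  rectangle-shiftʳ : ∀ I J (F : ℕ → ℕ → ℤ) →
    rectangle I (suc J) (λ i j → shift (F i) j) ≡ rectangle I J F
  rectangle-shiftʳ I J F = sumℤ≤-cong I λ i →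
    trans (sumℤ≤-suc J (shift (F i))) (ℤ.+-identityˡ (sumℤ≤ J (F i)))

  -- The recurrence for aₙ

  module _ (α a : ℤ) where

    e₁ e₂ e₃ : ℤ
    e₁ = + 3 * a
    e₂ = + 3 * a * a - + 3 * α
    e₃ = a * a * a + α - + 3 * a * α + α * α

    combine : ℤ → ℤ → ℤ → ℤ
    combine u v w = e₁ * u + (- e₂) * v + e₃ * w

    combine-cong : ∀ {u u′ v v′ w w′} → u ≡ u′ → v ≡ v′ → w ≡ w′ →
      combine u v w ≡ combine u′ v′ w′
    combine-cong refl refl refl = refl

    weight : ℕ → ℕ → ℕ
    weight i j = 2 ℕ.* i ℕ.+ 3 ℕ.* j

    weight-sucˡ : ∀ i j → 2 ℕ.* suc i ℕ.+ 3 ℕ.* j ≡ 2 ℕ.+ (2 ℕ.* i ℕ.+ 3 ℕ.* j)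
    weight-sucˡ = ℕ-solve-∀

    weight-sucʳ : ∀ i j → 2 ℕ.* i ℕ.+ 3 ℕ.* suc j ≡ 3 ℕ.+ (2 ℕ.* i ℕ.+ 3 ℕ.* j)
    weight-sucʳ = ℕ-solve-∀

    summand : ℕ → ℕ → ℕ → ℤ
    summand n i j = if weight i j ≤ᵇ n then term α a n i j else + 0

    ij-factor : ℕ → ℕ → ℤ
    ij-factor = weighted (- e₂) e₃

    r-factor : ℕ → ℕ → ℤ
    r-factor s r = weighted e₁ (+ 1) r s

    -- The (i, j) summand of aₙ for n = 2i + 3j + r.
    monomial : ℕ → ℕ → ℕ → ℤ
    monomial i j r = ij-factor i j * r-factor (i ℕ.+ j) r

    monomial-neighbours : ℕ → ℕ → ℕ → ℤ
    monomial-neighbours i j r =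
      combine (shift (monomial i j) r) (shift (λ i′ → monomial i′ j r) i) (shift (λ j′ → monomial i j′ r) j)

    term-monomial : ∀ {n} i j r → weight i j ℕ.+ r ≡ n → term α a n i j ≡ monomial i j r
    term-monomial {n} i j r w+r≡n = begin
      term α a n i j
        ≡⟨ cong₂ (λ k l → (- + 1) ^ i * + binomial i j * + (k C (i ℕ.+ j)) * e₁ ^ l * e₂ ^ i * e₃ ^ j)
                 first-index second-index ⟩
      (- + 1) ^ i * + binomial i j * + binomial r (i ℕ.+ j) * e₁ ^ r * e₂ ^ i * e₃ ^ j
        ≡⟨ ring ((- + 1) ^ i) (+ binomial i j) (+ binomial r (i ℕ.+ j)) (e₁ ^ r) (e₂ ^ i) (e₃ ^ j) ⟩
      + binomial i j * ((- + 1) ^ i * e₂ ^ i) * e₃ ^ j * (+ binomial r (i ℕ.+ j) * e₁ ^ r * + 1)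
        ≡⟨ cong₂ (λ u v → + binomial i j * u * e₃ ^ j * (+ binomial r (i ℕ.+ j) * e₁ ^ r * v))
                 ([-1]^i*x^i≡[-x]^i e₂ i) (sym (ℤ.^-zeroˡ (i ℕ.+ j))) ⟩
      monomial i j r ∎
      where
      ring : ∀ s b c P E F → s * b * c * P * E * F ≡ b * (s * E) * F * (c * P * + 1)
      ring = solve-∀
      split : ∀ i j r → 2 ℕ.* i ℕ.+ 3 ℕ.* j ℕ.+ r ≡ i ℕ.+ 2 ℕ.* j ℕ.+ (r ℕ.+ (i ℕ.+ j))
      split = ℕ-solve-∀
      first-index : n ℕ.∸ i ℕ.∸ 2 ℕ.* j ≡ r ℕ.+ (i ℕ.+ j)
      first-index = begin
        n ℕ.∸ i ℕ.∸ 2 ℕ.* j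
          ≡⟨ ℕ.∸-+-assoc n i (2 ℕ.* j) ⟩
        n ℕ.∸ (i ℕ.+ 2 ℕ.* j)
          ≡⟨ cong (ℕ._∸ (i ℕ.+ 2 ℕ.* j)) (trans (sym w+r≡n) (split i j r)) ⟩
        i ℕ.+ 2 ℕ.* j ℕ.+ (r ℕ.+ (i ℕ.+ j)) ℕ.∸ (i ℕ.+ 2 ℕ.* j)
          ≡⟨ ℕ.m+n∸m≡n (i ℕ.+ 2 ℕ.* j) _ ⟩
        r ℕ.+ (i ℕ.+ j) ∎
      second-index : n ℕ.∸ 2 ℕ.* i ℕ.∸ 3 ℕ.* j ≡ r
      second-index = begin
        n ℕ.∸ 2 ℕ.* i ℕ.∸ 3 ℕ.* j          ≡⟨ ℕ.∸-+-assoc n (2 ℕ.* i) (3 ℕ.* j) ⟩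
        n ℕ.∸ weight i j                    ≡⟨ cong (ℕ._∸ weight i j) (sym w+r≡n) ⟩
        weight i j ℕ.+ r ℕ.∸ weight i j      ≡⟨ ℕ.m+n∸m≡n (weight i j) r ⟩
        r                                   ∎

    monomial-shift-r : ∀ i j r s → i ℕ.+ j ≡ suc s →
      ij-factor i j * shift (r-factor (suc s)) r ≡ shift (monomial i j) r
    monomial-shift-r i j r s i+j≡1+s =
      trans (shift-*ˡ (ij-factor i j) (r-factor (suc s)) r)
            (cong (λ t → shift (λ r′ → ij-factor i j * r-factor t r′) r) (sym i+j≡1+s))

    monomial-shift-i : ∀ i j r s → i ℕ.+ j ≡ suc s →
      shift (λ i′ → ij-factor i′ j) i * r-factor s r ≡ shift (λ i′ → monomial i′ j r) i
    monomial-shift-i zero     j r s _  = ℤ.*-zeroˡ (r-factor s r)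
    monomial-shift-i (suc i′) j r s eq =
      cong (λ t → ij-factor i′ j * r-factor t r) (sym (ℕ.suc-injective eq))

    monomial-shift-j : ∀ i j r s → i ℕ.+ j ≡ suc s →
      shift (ij-factor i) j * r-factor s r ≡ shift (λ j′ → monomial i j′ r) j
    monomial-shift-j i zero     r s _  = ℤ.*-zeroˡ (r-factor s r)
    monomial-shift-j i (suc j′) r s eq =
      cong (λ t → ij-factor i j′ * r-factor t r) (sym (ℕ.suc-injective (trans (sym (ℕ.+-suc i j′)) eq)))

    monomial-rec⁺ : ∀ i j r s → i ℕ.+ j ≡ suc s → monomial i j r ≡ monomial-neighbours i j r
    monomial-rec⁺ i j r s i+j≡1+s = begin
      H * r-factor (i ℕ.+ j) r
        ≡⟨ cong (λ t → H * r-factor t r) i+j≡1+s ⟩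
      H * r-factor (suc s) r
        ≡⟨ cong (H *_) (weighted-pascal e₁ (+ 1) r (suc s) 0<r+1+s) ⟩
      H * (e₁ * P + + 1 * G)
        ≡⟨ ring₁ H e₁ P G ⟩
      e₁ * (H * P) + H * G
        ≡⟨ cong (λ h → e₁ * (H * P) + h * G) (weighted-pascal (- e₂) e₃ i j 0<i+j) ⟩
      e₁ * (H * P) + ((- e₂) * Hᵢ + e₃ * Hⱼ) * G
        ≡⟨ ring₂ e₁ (- e₂) e₃ (H * P) Hᵢ Hⱼ G ⟩
      combine (H * P) (Hᵢ * G) (Hⱼ * G)
        ≡⟨ combine-cong (monomial-shift-r i j r s i+j≡1+s) (monomial-shift-i i j r s i+j≡1+s)
                        (monomial-shift-j i j r s i+j≡1+s) ⟩
      monomial-neighbours i j r ∎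
      where
      H  = ij-factor i j
      Hᵢ = shift (λ i′ → ij-factor i′ j) i
      Hⱼ = shift (ij-factor i) j
      P  = shift (r-factor (suc s)) r
      G  = r-factor s r
      0<r+1+s = ℕ.<-≤-trans ℕ.z<s (ℕ.m≤n+m (suc s) r)
      0<i+j = subst (0 ℕ.<_) (sym i+j≡1+s) ℕ.z<s
      ring₁ : ∀ h e P G → h * (e * P + + 1 * G) ≡ e * (h * P) + h * G
      ring₁ = solve-∀
      ring₂ : ∀ x y z A B C G → x * A + (y * B + z * C) * G ≡ x * A + y * (B * G) + z * (C * G)
      ring₂ = solve-∀

    monomial-rec : ∀ i j r → 0 ℕ.< i ℕ.+ j ℕ.+ r → monomial i j r ≡ monomial-neighbours i j r
    monomial-rec zero    zero    (suc r) _ = ring e₁ e₂ e₃ (e₁ ^ r)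
      where
      ring : ∀ e₁ e₂ e₃ P → + 1 * + 1 * + 1 * (+ 1 * (e₁ * P) * + 1)
                            ≡ e₁ * (+ 1 * + 1 * + 1 * (+ 1 * P * + 1)) + (- e₂) * + 0 + e₃ * + 0
      ring = solve-∀
    monomial-rec (suc i) zero    r _ = monomial-rec⁺ (suc i) zero    r (i ℕ.+ 0)    refl
    monomial-rec zero    (suc j) r _ = monomial-rec⁺ zero    (suc j) r j            refl
    monomial-rec (suc i) (suc j) r _ = monomial-rec⁺ (suc i) (suc j) r (i ℕ.+ suc j) refl

    summand-vanish : ∀ {n} i j → n ℕ.< weight i j → summand n i j ≡ + 0
    summand-vanish {n} i j = if-≤ᵇ-false {weight i j} {n} {term α a n i j}

    summand-monomial : ∀ {n} i j r → weight i j ℕ.+ r ≡ n → summand n i j ≡ monomial i j r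
    summand-monomial {n} i j r w+r≡n =
      trans (if-≤ᵇ-true {weight i j} {n} {term α a n i j} (subst (weight i j ℕ.≤_) w+r≡n (ℕ.m≤m+n _ r)))
            (term-monomial i j r w+r≡n)

    -- The summands of aₙ placed at level n + 2 above two levels of zeros: the recurrence then
    -- holds at every level ≥ 3, so no initial values of (aₙ) need to be computed.
    padded : ℕ → ℕ → ℕ → ℤ
    padded zero          i j = + 0
    padded (suc zero)    i j = + 0
    padded (suc (suc n)) i j = summand n i j

    padded-neighbours : ℕ → ℕ → ℕ → ℤ
    padded-neighbours k i j =
      combine (padded (2 ℕ.+ k) i j) (shift (λ i′ → padded (1 ℕ.+ k) i′ j) i) (shift (padded k i) j)

    padded-vanish : ∀ {k} i j → k ℕ.< 2 ℕ.+ weight i j → padded k i j ≡ + 0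
    padded-vanish {zero}        i j _                     = refl
    padded-vanish {suc zero}    i j _                     = refl
    padded-vanish {suc (suc n)} i j (ℕ.s≤s (ℕ.s≤s n<w)) = summand-vanish i j n<w

    padded-monomial : ∀ {k} i j r → 2 ℕ.+ weight i j ℕ.+ r ≡ k → padded k i j ≡ monomial i j r
    padded-monomial {suc (suc n)} i j r refl = summand-monomial i j r refl

    padded-rec-inside : ∀ k i j r → weight i j ℕ.+ r ≡ suc k → padded (3 ℕ.+ k) i j ≡ padded-neighbours k i j
    padded-rec-inside k i j r w+r≡1+k = begin
      padded (3 ℕ.+ k) i j                      ≡⟨ padded-monomial i j r (cong (2 ℕ.+_) w+r≡1+k) ⟩
      monomial i j r                            ≡⟨ monomial-rec i j r (nonzero i j r w+r≡1+k) ⟩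
      monomial-neighbours i j r                 ≡⟨ sym (combine-cong (lower-r r w+r≡1+k) (lower-i i w+r≡1+k)
                                                                     (lower-j j w+r≡1+k)) ⟩
      padded-neighbours k i j ∎
      where
      nonzero : ∀ i j r → weight i j ℕ.+ r ≡ suc k → 0 ℕ.< i ℕ.+ j ℕ.+ r
      nonzero (suc i) j       r       _ = ℕ.z<s
      nonzero zero    (suc j) r       _ = ℕ.z<s
      nonzero zero    zero    (suc r) _ = ℕ.z<s
      lower-r : ∀ r → weight i j ℕ.+ r ≡ 1 ℕ.+ k → padded (2 ℕ.+ k) i j ≡ shift (monomial i j) r
      lower-r zero    eq =
        padded-vanish i j (ℕ.s≤s (ℕ.s≤s (ℕ.≤-reflexive (sym (trans (sym (ℕ.+-identityʳ (weight i j))) eq)))))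
      lower-r (suc r) eq =
        padded-monomial i j r (cong (2 ℕ.+_) (ℕ.suc-injective (trans (sym (ℕ.+-suc (weight i j) r)) eq)))
      lower-i : ∀ i → weight i j ℕ.+ r ≡ 1 ℕ.+ k →
        shift (λ i′ → padded (1 ℕ.+ k) i′ j) i ≡ shift (λ i′ → monomial i′ j r) i
      lower-i zero     _  = refl
      lower-i (suc i′) eq = padded-monomial i′ j r (trans (cong (ℕ._+ r) (sym (weight-sucˡ i′ j))) eq)
      lower-j : ∀ j → weight i j ℕ.+ r ≡ 1 ℕ.+ k → shift (padded k i) j ≡ shift (λ j′ → monomial i j′ r) j
      lower-j zero     _  = refl
      lower-j (suc j′) eq =
        padded-monomial i j′ r (ℕ.suc-injective (trans (cong (ℕ._+ r) (sym (weight-sucʳ i j′))) eq))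

    padded-rec-outside : ∀ k i j → 1 ℕ.+ k ℕ.< weight i j → padded (3 ℕ.+ k) i j ≡ padded-neighbours k i j
    padded-rec-outside k i j 1+k<w = begin
      padded (3 ℕ.+ k) i j       ≡⟨ padded-vanish i j (ℕ.s≤s (ℕ.s≤s 1+k<w)) ⟩
      + 0                        ≡⟨ ring e₁ e₂ e₃ ⟩
      combine (+ 0) (+ 0) (+ 0)  ≡⟨ sym (combine-cong (padded-vanish i j (ℕ.s≤s (ℕ.s≤s (ℕ.<-trans (ℕ.n<1+n k) 1+k<w))))
                                                      (lower-i i 1+k<w) (lower-j j 1+k<w)) ⟩
      padded-neighbours k i j ∎
      where
      ring : ∀ e₁ e₂ e₃ → + 0 ≡ e₁ * + 0 + (- e₂) * + 0 + e₃ * + 0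
      ring = solve-∀
      lower-i : ∀ i → 1 ℕ.+ k ℕ.< weight i j → shift (λ i′ → padded (1 ℕ.+ k) i′ j) i ≡ + 0
      lower-i zero     _  = refl
      lower-i (suc i′) lt = padded-vanish i′ j (subst (1 ℕ.+ k ℕ.<_) (weight-sucˡ i′ j) lt)
      lower-j : ∀ j → 1 ℕ.+ k ℕ.< weight i j → shift (padded k i) j ≡ + 0
      lower-j zero     _  = refl
      lower-j (suc j′) lt = padded-vanish i j′ (ℕ.≤-pred (subst (1 ℕ.+ k ℕ.<_) (weight-sucʳ i j′) lt))

    padded-rec : ∀ k i j → padded (3 ℕ.+ k) i j ≡ padded-neighbours k i j
    padded-rec k i j with weight i j ℕ.≤? 1 ℕ.+ k
    ... | yes w≤1+k = padded-rec-inside k i j (1 ℕ.+ k ℕ.∸ weight i j) (ℕ.m+[n∸m]≡n w≤1+k)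
    ... | no  w≰1+k = padded-rec-outside k i j (ℕ.≰⇒> w≰1+k)

    aseq⁺ : ℕ → ℤ
    aseq⁺ zero          = + 0
    aseq⁺ (suc zero)    = + 0
    aseq⁺ (suc (suc n)) = aseq α a n

    rectangle-padded : ∀ k {I J} → k ℕ.≤ I → k ℕ.≤ J → rectangle I J (padded k) ≡ aseq⁺ k
    rectangle-padded zero          {I} {J} _ _ = rectangle-zero I J (λ _ _ → refl)
    rectangle-padded (suc zero)    {I} {J} _ _ = rectangle-zero I J (λ _ _ → refl)
    rectangle-padded (suc (suc n)) {I} {J} k≤I k≤J =
      rectangle-extend outside (ℕ.≤-trans (ℕ.m≤n+m n 2) k≤I) (ℕ.≤-trans (ℕ.m≤n+m n 2) k≤J)
      where
      outside : ∀ i j → n ℕ.< i ⊎ n ℕ.< j → summand n i j ≡ + 0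
      outside i j (inj₁ n<i) =
        summand-vanish i j (ℕ.<-≤-trans n<i (ℕ.≤-trans (ℕ.m≤n*m i 2) (ℕ.m≤m+n (2 ℕ.* i) (3 ℕ.* j))))
      outside i j (inj₂ n<j) =
        summand-vanish i j (ℕ.<-≤-trans n<j (ℕ.≤-trans (ℕ.m≤n*m j 3) (ℕ.m≤n+m (3 ℕ.* j) (2 ℕ.* i))))

    aseq⁺-rec : ∀ k → aseq⁺ (3 ℕ.+ k) ≡ e₁ * aseq⁺ (2 ℕ.+ k) + (- e₂) * aseq⁺ (1 ℕ.+ k) + e₃ * aseq⁺ k
    aseq⁺-rec k = begin
      aseq⁺ (3 ℕ.+ k)
        ≡⟨ sym (rectangle-padded (3 ℕ.+ k) ℕ.≤-refl ℕ.≤-refl) ⟩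
      rectangle K K (padded (3 ℕ.+ k))
        ≡⟨ rectangle-cong K K (padded-rec k) ⟩
      rectangle K K (padded-neighbours k)
        ≡⟨ rectangle-linear K K e₁ (- e₂) e₃ _ _ _ ⟩
      combine (rectangle K K (padded (2 ℕ.+ k)))
              (rectangle K K (λ i j → shift (λ i′ → padded (1 ℕ.+ k) i′ j) i))
              (rectangle K K (λ i j → shift (padded k i) j))
        ≡⟨ combine-cong refl (rectangle-shiftˡ (2 ℕ.+ k) K (padded (1 ℕ.+ k)))
                             (rectangle-shiftʳ K (2 ℕ.+ k) (padded k)) ⟩
      combine (rectangle K K (padded (2 ℕ.+ k)))
              (rectangle (2 ℕ.+ k) K (padded (1 ℕ.+ k)))
              (rectangle K (2 ℕ.+ k) (padded k))
        ≡⟨ combine-cong (rectangle-padded (2 ℕ.+ k) (ℕ.n≤1+n _) (ℕ.n≤1+n _))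
                        (rectangle-padded (1 ℕ.+ k) (ℕ.n≤1+n _) (ℕ.m≤n+m (1 ℕ.+ k) 2))
                        (rectangle-padded k (ℕ.m≤n+m k 3) (ℕ.m≤n+m k 2)) ⟩
      combine (aseq⁺ (2 ℕ.+ k)) (aseq⁺ (1 ℕ.+ k)) (aseq⁺ k) ∎
      where
      K = 3 ℕ.+ k

open Recurrence using (aseq⁺; aseq⁺-rec; e₁; e₂; e₃)

open import Data.Integer as ℤ using (ℤ; +_; -[1+_])
import Data.Integer.Properties as ℤ
import Data.Nat.Coprimality as Coprimality
open import Data.Rational
  using (ℚ; mkℚ; 0ℚ; 1ℚ; ½; _+_; _*_; _-_; -_; _≤_; _<_; ∣_∣; *≤*; _/_; 1/_; _÷_; _⊓_; _⊔_;
         NonZero; positive; nonNegative; ≢-nonZero)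
import Data.Rational.Properties as ℚ
open import Algebra.Bundles using (CommutativeRing)
open import Tactic.RingSolver using (solve-∀)
open import Tactic.RingSolver.Core.AlmostCommutativeRing using (AlmostCommutativeRing; fromCommutativeRing)

ℚ-ring : AlmostCommutativeRing 0ℓ 0ℓ
ℚ-ring = fromCommutativeRing ℚ.+-*-commutativeRing (λ p → dec⇒maybe (0ℚ ℚ.≟ p))

open import Algebra.Properties.CommutativeSemiring.Exp
  (CommutativeRing.commutativeSemiring ℚ.+-*-commutativeRing) using (_^_; ^-distrib-*)

2ℚ 3ℚ 4ℚ 6ℚ : ℚ
2ℚ = 1ℚ + 1ℚ
3ℚ = 2ℚ + 1ℚ
4ℚ = 3ℚ + 1ℚ
6ℚ = 4ℚ + 2ℚ

fromℤ≡mkℚ : ∀ i → fromℤ i ≡ mkℚ i 0 (Coprimality.sym (Coprimality.1-coprimeTo ℤ.∣ i ∣))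
fromℤ≡mkℚ (+ n)    = ℚ.normalize-coprime (Coprimality.sym (Coprimality.1-coprimeTo n))
fromℤ≡mkℚ -[1+ n ] = cong -_ (ℚ.normalize-coprime (Coprimality.sym (Coprimality.1-coprimeTo (suc n))))

fromℤ-homo-* : ∀ i j → fromℤ (i ℤ.* j) ≡ fromℤ i * fromℤ j
fromℤ-homo-* i j = sym (cong₂ _*_ (fromℤ≡mkℚ i) (fromℤ≡mkℚ j))

fromℤ-homo-+ : ∀ i j → fromℤ (i ℤ.+ j) ≡ fromℤ i + fromℤ j
fromℤ-homo-+ i j = sym (trans (cong₂ _+_ (fromℤ≡mkℚ i) (fromℤ≡mkℚ j))
                              (cong (_/ 1) (cong₂ ℤ._+_ (ℤ.*-identityʳ i) (ℤ.*-identityʳ j))))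

neg-involutive : ∀ p → - (- p) ≡ p
neg-involutive = solve-∀ ℚ-ring

fromℤ-homo-neg : ∀ i → fromℤ (ℤ.- i) ≡ - fromℤ i
fromℤ-homo-neg (+ zero)  = refl
fromℤ-homo-neg (+ suc n) = refl
fromℤ-homo-neg -[1+ n ]  = sym (neg-involutive (fromℤ (+ suc n)))

fromℤ-homo-- : ∀ i j → fromℤ (i ℤ.- j) ≡ fromℤ i - fromℤ j
fromℤ-homo-- i j = trans (fromℤ-homo-+ i (ℤ.- j)) (cong (_+_ (fromℤ i)) (fromℤ-homo-neg j))

fromℤ-mono-≤ : ∀ {i j} → i ℤ.≤ j → fromℤ i ≤ fromℤ j
fromℤ-mono-≤ {i} {j} i≤j = subst₂ _≤_ (sym (fromℤ≡mkℚ i)) (sym (fromℤ≡mkℚ j))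
  (*≤* (subst₂ ℤ._≤_ (sym (ℤ.*-identityʳ i)) (sym (ℤ.*-identityʳ j)) i≤j))

≤-by-diff : ∀ {p q} d → q - p ≡ d → 0ℚ ≤ d → p ≤ q
≤-by-diff {p} {q} d q-p≡d 0≤d = subst₂ _≤_ (ℚ.+-identityˡ p) (shift-back p q)
  (ℚ.+-monoˡ-≤ p (subst (0ℚ ≤_) (sym q-p≡d) 0≤d))
  where
  shift-back : ∀ p q → q - p + p ≡ q
  shift-back = solve-∀ ℚ-ring

<-by-diff : ∀ {p q} d → q - p ≡ d → 0ℚ < d → p < q
<-by-diff {p} {q} d q-p≡d 0<d = subst₂ _<_ (ℚ.+-identityˡ p) (shift-back p q)
  (ℚ.+-monoˡ-< p (subst (0ℚ <_) (sym q-p≡d) 0<d))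
  where
  shift-back : ∀ p q → q - p + p ≡ q
  shift-back = solve-∀ ℚ-ring

p≤q⇒0≤q-p : ∀ {p q} → p ≤ q → 0ℚ ≤ q - p
p≤q⇒0≤q-p {p} {q} p≤q = subst (_≤ q - p) (ℚ.+-inverseʳ p) (ℚ.+-monoˡ-≤ (- p) p≤q)

p<q⇒0<q-p : ∀ {p q} → p < q → 0ℚ < q - p
p<q⇒0<q-p {p} {q} p<q = subst (_< q - p) (ℚ.+-inverseʳ p) (ℚ.+-monoˡ-< (- p) p<q)

nonNeg+ : ∀ {p q} → 0ℚ ≤ p → 0ℚ ≤ q → 0ℚ ≤ p + q
nonNeg+ = ℚ.+-mono-≤

pos+ : ∀ {p q} → 0ℚ < p → 0ℚ ≤ q → 0ℚ < p + q
pos+ = ℚ.+-mono-<-≤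

nonNeg* : ∀ {p q} → 0ℚ ≤ p → 0ℚ ≤ q → 0ℚ ≤ p * q
nonNeg* {p} {q} 0≤p 0≤q =
  ℚ.nonNegative⁻¹ _ {{ℚ.nonNeg*nonNeg⇒nonNeg p {{nonNegative 0≤p}} q {{nonNegative 0≤q}}}}

pos* : ∀ {p q} → 0ℚ < p → 0ℚ < q → 0ℚ < p * q
pos* {p} {q} 0<p 0<q = ℚ.positive⁻¹ _ {{ℚ.pos*pos⇒pos p {{positive 0<p}} q {{positive 0<q}}}}

square-nonNeg : ∀ p → 0ℚ ≤ p * p
square-nonNeg p with ℚ.≤-total 0ℚ p
... | inj₁ 0≤p = nonNeg* 0≤p 0≤p
... | inj₂ p≤0 = subst (0ℚ ≤_) (neg*neg p) (nonNeg* 0≤-p 0≤-p)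
  where
  0≤-p : 0ℚ ≤ - p
  0≤-p = ℚ.neg-antimono-≤ p≤0
  neg*neg : ∀ p → - p * - p ≡ p * p
  neg*neg = solve-∀ ℚ-ring

*-monoˡ-≤ : ∀ {r p q} → 0ℚ ≤ r → p ≤ q → r * p ≤ r * q
*-monoˡ-≤ {r} 0≤r = ℚ.*-monoˡ-≤-nonNeg r {{nonNegative 0≤r}}

*-monoʳ-≤ : ∀ {r p q} → 0ℚ ≤ r → p ≤ q → p * r ≤ q * r
*-monoʳ-≤ {r} 0≤r = ℚ.*-monoʳ-≤-nonNeg r {{nonNegative 0≤r}}

*-mono-≤ : ∀ {p q r s} → 0ℚ ≤ p → 0ℚ ≤ r → p ≤ q → r ≤ s → p * r ≤ q * s
*-mono-≤ 0≤p 0≤r p≤q r≤s = ℚ.≤-trans (*-monoʳ-≤ 0≤r p≤q) (*-monoˡ-≤ (ℚ.≤-trans 0≤p p≤q) r≤s)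

*-cancelˡ-≤ : ∀ {r p q} → 0ℚ < r → r * p ≤ r * q → p ≤ q
*-cancelˡ-≤ {r} 0<r = ℚ.*-cancelˡ-≤-pos r {{positive 0<r}}

*-cancelˡ-< : ∀ {r p q} → 0ℚ ≤ r → r * p < r * q → p < q
*-cancelˡ-< {r} 0≤r = ℚ.*-cancelˡ-<-nonNeg r {{nonNegative 0≤r}}

*-cancelʳ-< : ∀ {r p q} → 0ℚ ≤ r → p * r < q * r → p < q
*-cancelʳ-< {r} 0≤r = ℚ.*-cancelʳ-<-nonNeg r {{nonNegative 0≤r}}

pos*⇒pos : ∀ {r p} → 0ℚ < r → 0ℚ < r * p → 0ℚ < p
pos*⇒pos {r} 0<r 0<rp = *-cancelˡ-< (ℚ.<⇒≤ 0<r) (subst (_< r * _) (sym (ℚ.*-zeroʳ r)) 0<rp)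

nonNeg*⇒nonNeg : ∀ {r p} → 0ℚ < r → 0ℚ ≤ r * p → 0ℚ ≤ p
nonNeg*⇒nonNeg {r} 0<r 0≤rp = *-cancelˡ-≤ 0<r (subst (_≤ r * _) (sym (ℚ.*-zeroʳ r)) 0≤rp)

⊓-pos : ∀ {p q} → 0ℚ < p → 0ℚ < q → 0ℚ < p ⊓ q
⊓-pos {p} {q} 0<p 0<q with ℚ.⊓-sel p q
... | inj₁ p⊓q≡p = subst (0ℚ <_) (sym p⊓q≡p) 0<p
... | inj₂ p⊓q≡q = subst (0ℚ <_) (sym p⊓q≡q) 0<q

0<1 : 0ℚ < 1ℚ
0<1 = ℚ.positive⁻¹ 1ℚ

1/pos : (p : ℚ) → 0ℚ < p → ℚ
1/pos p 0<p = 1/ p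
  where instance _ = ℚ.pos⇒nonZero p {{positive 0<p}}

*-1/pos : ∀ p (0<p : 0ℚ < p) → p * 1/pos p 0<p ≡ 1ℚ
*-1/pos p 0<p = ℚ.*-inverseʳ p
  where instance _ = ℚ.pos⇒nonZero p {{positive 0<p}}

1/pos-pos : ∀ p (0<p : 0ℚ < p) → 0ℚ < 1/pos p 0<p
1/pos-pos p 0<p = ℚ.positive⁻¹ _ {{ℚ.1/pos⇒pos p {{positive 0<p}}}}

^-nonNeg : ∀ {p} m → 0ℚ ≤ p → 0ℚ ≤ p ^ m
^-nonNeg zero    _   = ℚ.<⇒≤ 0<1
^-nonNeg (suc m) 0≤p = nonNeg* 0≤p (^-nonNeg m 0≤p)

^-pos : ∀ {p} m → 0ℚ < p → 0ℚ < p ^ m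
^-pos zero    _   = 0<1
^-pos (suc m) 0<p = pos* 0<p (^-pos m 0<p)

^-mono-≤ : ∀ {p q} m → 0ℚ ≤ p → p ≤ q → p ^ m ≤ q ^ m
^-mono-≤ zero    _   _   = ℚ.≤-refl
^-mono-≤ (suc m) 0≤p p≤q = *-mono-≤ 0≤p (^-nonNeg m 0≤p) p≤q (^-mono-≤ m 0≤p p≤q)

bernoulli : ∀ {h} m → 0ℚ ≤ h → 1ℚ + fromℤ (+ m) * h ≤ (1ℚ + h) ^ m
bernoulli {h} zero    _   = ℚ.≤-reflexive (trans (cong (_+_ 1ℚ) (ℚ.*-zeroˡ h)) (ℚ.+-identityʳ 1ℚ))
bernoulli {h} (suc m) 0≤h = begin
  1ℚ + fromℤ (+ suc m) * h    ≡⟨ cong (λ k → 1ℚ + k * h) (fromℤ-homo-+ (+ 1) (+ m)) ⟩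
  1ℚ + (1ℚ + M) * h           ≤⟨ ≤-by-diff (M * (h * h)) (expand h M) (nonNeg* 0≤M (square-nonNeg h)) ⟩
  (1ℚ + h) * (1ℚ + M * h)     ≤⟨ *-monoˡ-≤ (nonNeg+ (ℚ.<⇒≤ 0<1) 0≤h) (bernoulli m 0≤h) ⟩
  (1ℚ + h) ^ suc m            ∎
  where
  open ℚ.≤-Reasoning
  M = fromℤ (+ m)
  0≤M : 0ℚ ≤ M
  0≤M = fromℤ-mono-≤ (ℤ.+≤+ (ℕ.z≤n {m}))
  expand : ∀ h M → (1ℚ + h) * (1ℚ + M * h) - (1ℚ + (1ℚ + M) * h) ≡ M * (h * h)
  expand = solve-∀ ℚ-ring

archimedean : ∀ p → Σ ℕ λ N → p ≤ fromℤ (+ N)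
archimedean p@(mkℚ n d _) = ℤ.∣ n ∣ , subst (p ≤_) (sym (fromℤ≡mkℚ (+ ℤ.∣ n ∣))) (*≤* n≤∣n∣[1+d])
  where
  n≤∣n∣[1+d] : n ℤ.* + 1 ℤ.≤ + ℤ.∣ n ∣ ℤ.* + suc d
  n≤∣n∣[1+d] = begin
    n ℤ.* + 1          ≡⟨ ℤ.*-identityʳ n ⟩
    n                  ≤⟨ i≤∣i∣ n ⟩
    + ℤ.∣ n ∣           ≤⟨ ℤ.+≤+ (ℕ.m≤m*n ℤ.∣ n ∣ (suc d)) ⟩
    + (ℤ.∣ n ∣ ℕ.* suc d) ≡⟨ ℤ.pos-* ℤ.∣ n ∣ (suc d) ⟩
    + ℤ.∣ n ∣ ℤ.* + suc d ∎
    where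
    open ℤ.≤-Reasoning
    i≤∣i∣ : ∀ i → i ℤ.≤ + ℤ.∣ i ∣
    i≤∣i∣ (+ _)    = ℤ.≤-refl
    i≤∣i∣ -[1+ _ ] = ℤ.-≤+

cube-mono-< : ∀ {p q} → p < q → cube p < cube q
cube-mono-< {p} {q} p<q = <-by-diff _ (factor p q)
  (pos* (pos* 0<q-p (pos+ (pos* 0<q-p 0<q-p) (nonNeg* (ℚ.<⇒≤ (ℚ.positive⁻¹ 3ℚ)) (square-nonNeg (p + q)))))
        (ℚ.positive⁻¹ (½ * ½)))
  where
  0<q-p = p<q⇒0<q-p p<q
  factor : ∀ p q → q * q * q - p * p * p ≡ (q - p) * ((q - p) * (q - p) + 3ℚ * ((p + q) * (p + q))) * (½ * ½)
  factor = solve-∀ ℚ-ring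

cube-mono-≤ : ∀ {p q} → p ≤ q → cube p ≤ cube q
cube-mono-≤ {p} {q} p≤q = ≤-by-diff _ (factor p q)
  (nonNeg* (nonNeg* 0≤q-p (nonNeg+ (square-nonNeg (q - p)) (nonNeg* (ℚ.<⇒≤ (ℚ.positive⁻¹ 3ℚ)) (square-nonNeg (p + q)))))
           (ℚ.<⇒≤ (ℚ.positive⁻¹ (½ * ½))))
  where
  0≤q-p = p≤q⇒0≤q-p p≤q
  factor : ∀ p q → q * q * q - p * p * p ≡ (q - p) * ((q - p) * (q - p) + 3ℚ * ((p + q) * (p + q))) * (½ * ½)
  factor = solve-∀ ℚ-ring

cube-cancel-< : ∀ {p q} → cube p < cube q → p < q
cube-cancel-< p³<q³ = ℚ.≰⇒> (λ q≤p → ℚ.<-irrefl refl (ℚ.<-≤-trans p³<q³ (cube-mono-≤ q≤p)))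

p≤∣p∣ : ∀ p → p ≤ ∣ p ∣
p≤∣p∣ p with ℚ.≤-total 0ℚ p
... | inj₁ 0≤p = ℚ.≤-reflexive (sym (ℚ.0≤p⇒∣p∣≡p 0≤p))
... | inj₂ p≤0 = ℚ.≤-trans p≤0 (ℚ.0≤∣p∣ p)

∣p∣≤q⇒-q≤p≤q : ∀ {p q} → ∣ p ∣ ≤ q → - q ≤ p × p ≤ q
∣p∣≤q⇒-q≤p≤q {p} {q} ∣p∣≤q =
  subst (- q ≤_) (neg-involutive p)
        (ℚ.neg-antimono-≤ (ℚ.≤-trans (p≤∣p∣ (- p)) (subst (_≤ q) (sym (ℚ.∣-p∣≡∣p∣ p)) ∣p∣≤q))) ,
  ℚ.≤-trans (p≤∣p∣ p) ∣p∣≤q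

-q≤p≤q⇒∣p∣≤q : ∀ {p q} → - q ≤ p → p ≤ q → ∣ p ∣ ≤ q
-q≤p≤q⇒∣p∣≤q {p} {q} -q≤p p≤q with ℚ.∣p∣≡p∨∣p∣≡-p p
... | inj₁ ∣p∣≡p  = subst (_≤ q) (sym ∣p∣≡p) p≤q
... | inj₂ ∣p∣≡-p = subst (_≤ q) (sym ∣p∣≡-p) (subst (- p ≤_) (neg-involutive q) (ℚ.neg-antimono-≤ -q≤p))

square-≤⇒∣∣-≤ : ∀ {p q} → 0ℚ ≤ q → p * p ≤ q * q → ∣ p ∣ ≤ q
square-≤⇒∣∣-≤ {p} {q} 0≤q p²≤q² = ℚ.≮⇒≥ λ q<∣p∣ → ℚ.<-irrefl refl (ℚ.<-≤-trans (q²<p² q<∣p∣) p²≤q²)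
  where
  ∣p∣²≡p² : ∣ p ∣ * ∣ p ∣ ≡ p * p
  ∣p∣²≡p² = trans (sym (ℚ.∣p*q∣≡∣p∣*∣q∣ p p)) (ℚ.0≤p⇒∣p∣≡p (square-nonNeg p))
  q²<p² : q < ∣ p ∣ → q * q < p * p
  q²<p² q<∣p∣ = subst (q * q <_) ∣p∣²≡p²
    (ℚ.≤-<-trans (*-monoˡ-≤ 0≤q (ℚ.<⇒≤ q<∣p∣))
                 (ℚ.*-monoˡ-<-pos ∣ p ∣ {{positive (ℚ.≤-<-trans 0≤q q<∣p∣)}} q<∣p∣))

p≤cube-p : ∀ {p} → 1ℚ ≤ p → p ≤ cube p
p≤cube-p {p} 1≤p = ≤-by-diff _ (factor p) (nonNeg* (nonNeg* 0≤p (p≤q⇒0≤q-p 1≤p)) (nonNeg+ 0≤p (ℚ.<⇒≤ 0<1)))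
  where
  0≤p = ℚ.≤-trans (ℚ.<⇒≤ 0<1) 1≤p
  factor : ∀ p → p * p * p - p ≡ p * (p - 1ℚ) * (p + 1ℚ)
  factor = solve-∀ ℚ-ring

*-1/pos-cancel : ∀ p c (0<p : 0ℚ < p) → p * (c * 1/pos p 0<p) ≡ c
*-1/pos-cancel p c 0<p = trans (swap p c (1/pos p 0<p)) (trans (cong (c *_) (*-1/pos p 0<p)) (ℚ.*-identityʳ c))
  where
  swap : ∀ p c i → p * (c * i) ≡ c * (p * i)
  swap = solve-∀ ℚ-ring

-- The cubic algebra ℚ[t]/(t³ − b)

-- ⟨ c₀ , c₁ , c₂ ⟩ stands for c₀ + c₁ t + c₂ t², for a b fixed by the context.
record Cubic : Set where
  constructor ⟨_,_,_⟩
  field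
    c₀ c₁ c₂ : ℚ
open Cubic

-- Multiplication by u = a + t + t².
mulU : ℚ → ℚ → Cubic → Cubic
mulU a b v = ⟨ a * c₀ v + b * c₁ v + b * c₂ v , c₀ v + a * c₁ v + b * c₂ v , c₀ v + c₁ v + a * c₂ v ⟩

powU : ℚ → ℚ → ℕ → Cubic
powU a b zero    = ⟨ 1ℚ , 0ℚ , 0ℚ ⟩
powU a b (suc m) = mulU a b (powU a b m)

-- e₁, e₂, e₃ of the recurrence, with b in place of α.
σ₁ : ℚ → ℚ
σ₁ a = 3ℚ * a

σ₂ σ₃ : ℚ → ℚ → ℚ
σ₂ a b = 3ℚ * a * a - 3ℚ * b
σ₃ a b = a * a * a + b - 3ℚ * a * b + b * b

coefficient-gap : ℚ → ℚ → ℕ → ℚ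
coefficient-gap a b m = c₁ (powU a b m) - c₂ (powU a b m)

cayley-hamilton : ∀ a b x y z →
  let x₁ = a * x + b * y + b * z
      y₁ = x + a * y + b * z
      z₁ = x + y + a * z
      x₂ = a * x₁ + b * y₁ + b * z₁
      y₂ = x₁ + a * y₁ + b * z₁
      z₂ = x₁ + y₁ + a * z₁
      s₁ = 3ℚ * a
      s₂ = 3ℚ * a * a - 3ℚ * b
      s₃ = a * a * a + b - 3ℚ * a * b + b * b
  in (x₂ + a * y₂ + b * z₂) - (x₂ + y₂ + a * z₂) ≡ s₁ * (y₂ - z₂) + (- s₂) * (y₁ - z₁) + s₃ * (y - z)
cayley-hamilton = solve-∀ ℚ-ring

coefficient-gap-rec : ∀ a b m →
  coefficient-gap a b (3 ℕ.+ m)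
    ≡ σ₁ a * coefficient-gap a b (2 ℕ.+ m) + (- σ₂ a b) * coefficient-gap a b (1 ℕ.+ m) + σ₃ a b * coefficient-gap a b m
coefficient-gap-rec a b m = cayley-hamilton a b (c₀ v) (c₁ v) (c₂ v)
  where v = powU a b m

fromℤ-e₁ : ∀ α a → fromℤ (e₁ α a) ≡ σ₁ (fromℤ a)
fromℤ-e₁ α a = fromℤ-homo-* (+ 3) a

fromℤ-e₂ : ∀ α a → fromℤ (e₂ α a) ≡ σ₂ (fromℤ a) (fromℤ α)
fromℤ-e₂ α a = begin
  fromℤ (+ 3 ℤ.* a ℤ.* a ℤ.- + 3 ℤ.* α)             ≡⟨ fromℤ-homo-- (+ 3 ℤ.* a ℤ.* a) (+ 3 ℤ.* α) ⟩
  fromℤ (+ 3 ℤ.* a ℤ.* a) - fromℤ (+ 3 ℤ.* α)        ≡⟨ cong₂ _-_ (trans (fromℤ-homo-* (+ 3 ℤ.* a) a)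
                                                                         (cong (_* fromℤ a) (fromℤ-homo-* (+ 3) a)))
                                                                  (fromℤ-homo-* (+ 3) α) ⟩
  σ₂ (fromℤ a) (fromℤ α)                             ∎
  where open ≡-Reasoning

fromℤ-e₃ : ∀ α a → fromℤ (e₃ α a) ≡ σ₃ (fromℤ a) (fromℤ α)
fromℤ-e₃ α a = begin
  fromℤ (a ℤ.* a ℤ.* a ℤ.+ α ℤ.- + 3 ℤ.* a ℤ.* α ℤ.+ α ℤ.* α)
    ≡⟨ fromℤ-homo-+ (a ℤ.* a ℤ.* a ℤ.+ α ℤ.- + 3 ℤ.* a ℤ.* α) (α ℤ.* α) ⟩
  fromℤ (a ℤ.* a ℤ.* a ℤ.+ α ℤ.- + 3 ℤ.* a ℤ.* α) + fromℤ (α ℤ.* α)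
    ≡⟨ cong₂ _+_ (fromℤ-homo-- (a ℤ.* a ℤ.* a ℤ.+ α) (+ 3 ℤ.* a ℤ.* α)) (fromℤ-homo-* α α) ⟩
  fromℤ (a ℤ.* a ℤ.* a ℤ.+ α) - fromℤ (+ 3 ℤ.* a ℤ.* α) + A * A
    ≡⟨ cong₂ (λ u v → u - v + A * A) (fromℤ-homo-+ (a ℤ.* a ℤ.* a) α) (fromℤ-homo-* (+ 3 ℤ.* a) α) ⟩
  fromℤ (a ℤ.* a ℤ.* a) + A - fromℤ (+ 3 ℤ.* a) * A + A * A
    ≡⟨ cong₂ (λ u v → u + A - v * A + A * A)
             (trans (fromℤ-homo-* (a ℤ.* a) a) (cong (_* a′) (fromℤ-homo-* a a))) (fromℤ-homo-* (+ 3) a) ⟩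
  σ₃ a′ A ∎
  where
  open ≡-Reasoning
  A  = fromℤ α
  a′ = fromℤ a

fromℤ-aseq⁺-rec : ∀ α a k → let A = fromℤ α ; a′ = fromℤ a in
  fromℤ (aseq⁺ α a (3 ℕ.+ k))
    ≡ σ₁ a′ * fromℤ (aseq⁺ α a (2 ℕ.+ k)) + (- σ₂ a′ A) * fromℤ (aseq⁺ α a (1 ℕ.+ k)) + σ₃ a′ A * fromℤ (aseq⁺ α a k)
fromℤ-aseq⁺-rec α a k = begin
  fromℤ (aseq⁺ α a (3 ℕ.+ k))
    ≡⟨ cong fromℤ (aseq⁺-rec α a k) ⟩
  fromℤ (e₁ α a ℤ.* a₂ ℤ.+ (ℤ.- e₂ α a) ℤ.* a₁ ℤ.+ e₃ α a ℤ.* a₀)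
    ≡⟨ trans (fromℤ-homo-+ (e₁ α a ℤ.* a₂ ℤ.+ (ℤ.- e₂ α a) ℤ.* a₁) (e₃ α a ℤ.* a₀))
             (cong (_+ fromℤ (e₃ α a ℤ.* a₀)) (fromℤ-homo-+ (e₁ α a ℤ.* a₂) ((ℤ.- e₂ α a) ℤ.* a₁))) ⟩
  fromℤ (e₁ α a ℤ.* a₂) + fromℤ ((ℤ.- e₂ α a) ℤ.* a₁) + fromℤ (e₃ α a ℤ.* a₀)
    ≡⟨ cong₂ _+_ (cong₂ _+_ (trans (fromℤ-homo-* (e₁ α a) a₂) (cong (_* fromℤ a₂) (fromℤ-e₁ α a)))
                            (trans (fromℤ-homo-* (ℤ.- e₂ α a) a₁)
                                   (cong (_* fromℤ a₁) (trans (fromℤ-homo-neg (e₂ α a)) (cong -_ (fromℤ-e₂ α a))))))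
                 (trans (fromℤ-homo-* (e₃ α a) a₀) (cong (_* fromℤ a₀) (fromℤ-e₃ α a))) ⟩
  σ₁ (fromℤ a) * fromℤ a₂ + (- σ₂ (fromℤ a) (fromℤ α)) * fromℤ a₁ + σ₃ (fromℤ a) (fromℤ α) * fromℤ a₀ ∎
  where
  open ≡-Reasoning
  a₂ = aseq⁺ α a (2 ℕ.+ k)
  a₁ = aseq⁺ α a (1 ℕ.+ k)
  a₀ = aseq⁺ α a k

aseq⁺-coefficient-gap : ∀ α a m → (fromℤ α - 1ℚ) * fromℤ (aseq⁺ α a m) ≡ coefficient-gap (fromℤ a) (fromℤ α) m
aseq⁺-coefficient-gap α a zero = ℚ.*-zeroʳ (fromℤ α - 1ℚ)
aseq⁺-coefficient-gap α a (suc zero) = gap₁ (fromℤ α) (fromℤ a)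
  where
  gap₁ : ∀ A a → (A - 1ℚ) * 0ℚ ≡ (1ℚ + a * 0ℚ + A * 0ℚ) - (1ℚ + 0ℚ + a * 0ℚ)
  gap₁ = solve-∀ ℚ-ring
aseq⁺-coefficient-gap α a (suc (suc zero)) = gap₂ (fromℤ α) (fromℤ a)
  where
  gap₂ : ∀ A a →
    let x₁ = a * 1ℚ + A * 0ℚ + A * 0ℚ
        y₁ = 1ℚ + a * 0ℚ + A * 0ℚ
        z₁ = 1ℚ + 0ℚ + a * 0ℚ
    in (A - 1ℚ) * 1ℚ ≡ (x₁ + a * y₁ + A * z₁) - (x₁ + y₁ + a * z₁)
  gap₂ = solve-∀ ℚ-ring
aseq⁺-coefficient-gap α a (suc (suc (suc k))) = begin
  (A - 1ℚ) * fromℤ (aseq⁺ α a (3 ℕ.+ k))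
    ≡⟨ cong ((A - 1ℚ) *_) (fromℤ-aseq⁺-rec α a k) ⟩
  (A - 1ℚ) * (s₁ * fromℤ a₂ + s₂ * fromℤ a₁ + s₃ * fromℤ a₀)
    ≡⟨ distrib (A - 1ℚ) s₁ s₂ s₃ (fromℤ a₂) (fromℤ a₁) (fromℤ a₀) ⟩
  s₁ * ((A - 1ℚ) * fromℤ a₂) + s₂ * ((A - 1ℚ) * fromℤ a₁) + s₃ * ((A - 1ℚ) * fromℤ a₀)
    ≡⟨ cong₂ _+_ (cong₂ (λ u v → s₁ * u + s₂ * v) (aseq⁺-coefficient-gap α a (suc (suc k)))
                                                               (aseq⁺-coefficient-gap α a (suc k)))
                             (cong (s₃ *_) (aseq⁺-coefficient-gap α a k)) ⟩
  s₁ * coefficient-gap a′ A (2 ℕ.+ k) + s₂ * coefficient-gap a′ A (1 ℕ.+ k) + s₃ * coefficient-gap a′ A k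
    ≡⟨ sym (coefficient-gap-rec a′ A k) ⟩
  coefficient-gap a′ A (3 ℕ.+ k) ∎
  where
  open ≡-Reasoning
  A  = fromℤ α
  a′ = fromℤ a
  s₁ = σ₁ a′
  s₂ = - σ₂ a′ A
  s₃ = σ₃ a′ A
  a₂ = aseq⁺ α a (2 ℕ.+ k)
  a₁ = aseq⁺ α a (1 ℕ.+ k)
  a₀ = aseq⁺ α a k
  distrib : ∀ d x y z u v w → d * (x * u + y * v + z * w) ≡ x * (d * u) + y * (d * v) + z * (d * w)
  distrib = solve-∀ ℚ-ring

norm : ℚ → Cubic → ℚ
norm b v = c₀ v * c₀ v * c₀ v + b * (c₁ v * c₁ v * c₁ v) + b * b * (c₂ v * c₂ v * c₂ v) - 3ℚ * b * c₀ v * c₁ v * c₂ v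

norm-mulU : ∀ a b v → norm b (mulU a b v) ≡ σ₃ a b * norm b v
norm-mulU a b v = multiplicative a b (c₀ v) (c₁ v) (c₂ v)
  where
  multiplicative : ∀ a b x y z →
    let x′ = a * x + b * y + b * z
        y′ = x + a * y + b * z
        z′ = x + y + a * z
    in x′ * x′ * x′ + b * (y′ * y′ * y′) + b * b * (z′ * z′ * z′) - 3ℚ * b * x′ * y′ * z′
       ≡ (a * a * a + b - 3ℚ * a * b + b * b) * (x * x * x + b * (y * y * y) + b * b * (z * z * z) - 3ℚ * b * x * y * z)
  multiplicative = solve-∀ ℚ-ring

norm-powU : ∀ a b m → norm b (powU a b m) ≡ σ₃ a b ^ m
norm-powU a b zero    = norm-one b
  where
  norm-one : ∀ b → 1ℚ * 1ℚ * 1ℚ + b * (0ℚ * 0ℚ * 0ℚ) + b * b * (0ℚ * 0ℚ * 0ℚ) - 3ℚ * b * 1ℚ * 0ℚ * 0ℚ ≡ 1ℚ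
  norm-one = solve-∀ ℚ-ring
norm-powU a b (suc m) = trans (norm-mulU a b (powU a b m)) (cong (σ₃ a b *_) (norm-powU a b m))

-- Evaluation at t = s, a ring homomorphism ℚ[t]/(t³ − s³) → ℚ.
evalAt : ℚ → Cubic → ℚ
evalAt s v = c₀ v + c₁ v * s + c₂ v * (s * s)

θ : ℚ → ℚ → ℚ
θ a s = a + s + s * s

evalAt-mulU : ∀ a s v → evalAt s (mulU a (cube s) v) ≡ θ a s * evalAt s v
evalAt-mulU a s v = homomorphic a s (c₀ v) (c₁ v) (c₂ v)
  where
  homomorphic : ∀ a s x y z →
    let b = s * s * s
    in (a * x + b * y + b * z) + (x + a * y + b * z) * s + (x + y + a * z) * (s * s)
       ≡ (a + s + s * s) * (x + y * s + z * (s * s))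
  homomorphic = solve-∀ ℚ-ring

evalAt-powU : ∀ a s m → evalAt s (powU a (cube s) m) ≡ θ a s ^ m
evalAt-powU a s zero    = one s
  where
  one : ∀ s → 1ℚ + 0ℚ * s + 0ℚ * (s * s) ≡ 1ℚ
  one = solve-∀ ℚ-ring
evalAt-powU a s (suc m) = trans (evalAt-mulU a s (powU a (cube s) m)) (cong (θ a s *_) (evalAt-powU a s m))

-- With b = s³ the norm factors as X·Q where X = evalAt s v and Q is a positive
-- semidefinite quadratic form; these are two ways of writing 4Q as a sum of squares.
norm-sos₁ : ∀ s v → let X = evalAt s v in
  4ℚ * norm (cube s) v
    ≡ X * ((3ℚ * c₁ v * s - X) * (3ℚ * c₁ v * s - X)) + 3ℚ * X * ((c₀ v - c₂ v * (s * s)) * (c₀ v - c₂ v * (s * s)))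
norm-sos₁ s v = sos s (c₀ v) (c₁ v) (c₂ v)
  where
  sos : ∀ s x y z → let X = x + y * s + z * (s * s) ; b = s * s * s in
    4ℚ * (x * x * x + b * (y * y * y) + b * b * (z * z * z) - 3ℚ * b * x * y * z)
      ≡ X * ((3ℚ * y * s - X) * (3ℚ * y * s - X)) + 3ℚ * X * ((x - z * (s * s)) * (x - z * (s * s)))
  sos = solve-∀ ℚ-ring

norm-sos₂ : ∀ s v → let X = evalAt s v in
  4ℚ * norm (cube s) v
    ≡ X * ((3ℚ * c₂ v * (s * s) - X) * (3ℚ * c₂ v * (s * s) - X)) + 3ℚ * X * ((c₀ v - c₁ v * s) * (c₀ v - c₁ v * s))
norm-sos₂ s v = sos s (c₀ v) (c₁ v) (c₂ v)
  where
  sos : ∀ s x y z → let X = x + y * s + z * (s * s) ; b = s * s * s in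
    4ℚ * (x * x * x + b * (y * y * y) + b * b * (z * z * z) - 3ℚ * b * x * y * z)
      ≡ X * ((3ℚ * z * (s * s) - X) * (3ℚ * z * (s * s) - X)) + 3ℚ * X * ((x - y * s) * (x - y * s))
  sos = solve-∀ ℚ-ring

sos-term-bound : ∀ {X E W N ζ} → 0ℚ < X → 0ℚ ≤ ζ →
  N ≡ X * (E * E) + 3ℚ * X * (W * W) → N ≤ ζ * ζ * cube X → ∣ E ∣ ≤ ζ * X
sos-term-bound {X} {E} {W} {N} {ζ} 0<X 0≤ζ N≡ N≤ =
  square-≤⇒∣∣-≤ (nonNeg* 0≤ζ (ℚ.<⇒≤ 0<X)) (*-cancelˡ-≤ 0<X (begin
  X * (E * E)                      ≤⟨ ≤-by-diff _ (drop X (E * E) (W * W))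
                                        (nonNeg* (nonNeg* (ℚ.<⇒≤ (ℚ.positive⁻¹ 3ℚ)) (ℚ.<⇒≤ 0<X)) (square-nonNeg W)) ⟩
  X * (E * E) + 3ℚ * X * (W * W)   ≡⟨ sym N≡ ⟩
  N                                ≤⟨ N≤ ⟩
  ζ * ζ * cube X                   ≡⟨ regroup ζ X ⟩
  X * ((ζ * X) * (ζ * X))          ∎))
  where
  open ℚ.≤-Reasoning
  drop : ∀ X E² W² → X * E² + 3ℚ * X * W² - X * E² ≡ 3ℚ * X * W²
  drop = solve-∀ ℚ-ring
  regroup : ∀ ζ X → ζ * ζ * (X * X * X) ≡ X * ((ζ * X) * (ζ * X))
  regroup = solve-∀ ℚ-ring

-- If the norm is small compared with the cube of the real conjugate X, then c₀ : c₁ : c₂ is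
-- close to the eigenvector s² : s : 1 of multiplication by t.
near-eigenvector : ∀ {s ζ} v → 0ℚ < s → 0ℚ ≤ ζ → ζ ≤ ½ → 0ℚ < evalAt s v →
  4ℚ * norm (cube s) v ≤ ζ * ζ * cube (evalAt s v) →
  evalAt s v ≤ 6ℚ * (s * s) * c₂ v × ∣ c₁ v - s * c₂ v ∣ ≤ 4ℚ * ζ * s * c₂ v
near-eigenvector {s} {ζ} v 0<s 0≤ζ ζ≤½ 0<X small = X≤6s²z , ∣y-sz∣≤
  where
  open ℚ.≤-Reasoning
  X = evalAt s v
  x = c₀ v
  y = c₁ v
  z = c₂ v
  E₁ = 3ℚ * y * s - X
  E₂ = 3ℚ * z * (s * s) - X
  ∣E₁∣≤ : ∣ E₁ ∣ ≤ ζ * X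
  ∣E₁∣≤ = sos-term-bound {W = x - z * (s * s)} 0<X 0≤ζ (norm-sos₁ s v) small
  ∣E₂∣≤ : ∣ E₂ ∣ ≤ ζ * X
  ∣E₂∣≤ = sos-term-bound {W = x - y * s} 0<X 0≤ζ (norm-sos₂ s v) small
  0≤1-2ζ : 0ℚ ≤ 1ℚ - 2ℚ * ζ
  0≤1-2ζ = p≤q⇒0≤q-p (*-monoˡ-≤ (ℚ.<⇒≤ (ℚ.positive⁻¹ 2ℚ)) ζ≤½)
  X≤6s²z : X ≤ 6ℚ * (s * s) * z
  X≤6s²z = ≤-by-diff _ (split ζ X z s)
    (nonNeg+ (nonNeg* (ℚ.<⇒≤ (ℚ.positive⁻¹ 2ℚ)) (p≤q⇒0≤q-p (proj₁ (∣p∣≤q⇒-q≤p≤q ∣E₂∣≤))))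
             (nonNeg* (ℚ.<⇒≤ 0<X) 0≤1-2ζ))
    where
    split : ∀ ζ X z s → 6ℚ * (s * s) * z - X
                         ≡ 2ℚ * ((3ℚ * z * (s * s) - X) - - (ζ * X)) + X * (1ℚ - 2ℚ * ζ)
    split = solve-∀ ℚ-ring
  0<3s : 0ℚ < 3ℚ * s
  0<3s = pos* (ℚ.positive⁻¹ 3ℚ) 0<s
  ∣y-sz∣≤ : ∣ y - s * z ∣ ≤ 4ℚ * ζ * s * z
  ∣y-sz∣≤ = *-cancelˡ-≤ 0<3s (begin
    3ℚ * s * ∣ y - s * z ∣        ≡⟨ cong (_* ∣ y - s * z ∣) (sym (ℚ.0≤p⇒∣p∣≡p (ℚ.<⇒≤ 0<3s))) ⟩
    ∣ 3ℚ * s ∣ * ∣ y - s * z ∣    ≡⟨ sym (ℚ.∣p*q∣≡∣p∣*∣q∣ (3ℚ * s) (y - s * z)) ⟩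
    ∣ 3ℚ * s * (y - s * z) ∣      ≡⟨ cong ∣_∣ (difference s X y z) ⟩
    ∣ E₁ - E₂ ∣                   ≤⟨ ℚ.∣p-q∣≤∣p∣+∣q∣ E₁ E₂ ⟩
    ∣ E₁ ∣ + ∣ E₂ ∣               ≤⟨ ℚ.+-mono-≤ ∣E₁∣≤ ∣E₂∣≤ ⟩
    ζ * X + ζ * X                 ≤⟨ ℚ.+-mono-≤ (*-monoˡ-≤ 0≤ζ X≤6s²z) (*-monoˡ-≤ 0≤ζ X≤6s²z) ⟩
    ζ * (6ℚ * (s * s) * z) + ζ * (6ℚ * (s * s) * z) ≡⟨ regroup ζ s z ⟩
    3ℚ * s * (4ℚ * ζ * s * z)     ∎)
    where
    difference : ∀ s X y z → 3ℚ * s * (y - s * z) ≡ (3ℚ * y * s - X) - (3ℚ * z * (s * s) - X)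
    difference = solve-∀ ℚ-ring
    regroup : ∀ ζ s z → ζ * (6ℚ * (s * s) * z) + ζ * (6ℚ * (s * s) * z) ≡ 3ℚ * s * (4ℚ * ζ * s * z)
    regroup = solve-∀ ℚ-ring

-- Dominance of the real conjugate

L : ℚ → ℚ → ℚ
L a q = q * q + a * (1ℚ + q)

θ-mono-≤ : ∀ a {q s} → 0ℚ ≤ q → q ≤ s → θ a q ≤ θ a s
θ-mono-≤ a {q} {s} 0≤q q≤s = ≤-by-diff _ (factor a q s)
  (nonNeg* (p≤q⇒0≤q-p q≤s) (nonNeg+ (nonNeg+ (ℚ.<⇒≤ 0<1) (ℚ.≤-trans 0≤q q≤s)) 0≤q))
  where
  factor : ∀ a q s → (a + s + s * s) - (a + q + q * q) ≡ (s - q) * (1ℚ + s + q)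
  factor = solve-∀ ℚ-ring

θ-pos : ∀ a {q} → 0ℚ < q → 0ℚ < L a q → 0ℚ < θ a q
θ-pos a {q} 0<q 0<L = pos*⇒pos (pos+ 0<1 (ℚ.<⇒≤ 0<q)) (subst (0ℚ <_) (sym (expand a q))
  (pos+ (pos+ (pos+ 0<L 0≤q) (square-nonNeg q)) (nonNeg* (square-nonNeg q) 0≤q)))
  where
  0≤q = ℚ.<⇒≤ 0<q
  expand : ∀ a q → (1ℚ + q) * (a + q + q * q) ≡ (q * q + a * (1ℚ + q)) + q + q * q + q * q * q
  expand = solve-∀ ℚ-ring

lower-bound⇒L-pos : ∀ a q → - (q * q) < a * (1ℚ + q) → 0ℚ < L a q
lower-bound⇒L-pos a q bound = subst (0ℚ <_) (flip q a) (p<q⇒0<q-p bound)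
  where
  flip : ∀ q a → a * (1ℚ + q) - - (q * q) ≡ q * q + a * (1ℚ + q)
  flip = solve-∀ ℚ-ring

L-pos-mono : ∀ a {q r} → 0ℚ < q → q ≤ r → 0ℚ < L a q → 0ℚ < L a r
L-pos-mono a {q} {r} 0<q q≤r 0<L = pos*⇒pos (pos+ 0<1 (ℚ.<⇒≤ 0<q)) (subst (0ℚ <_) (sym (expand a q r))
  (pos+ (pos* (pos+ 0<1 0≤r) 0<L)
        (nonNeg* (p≤q⇒0≤q-p q≤r) (nonNeg+ (nonNeg+ 0≤r (ℚ.<⇒≤ 0<q)) (nonNeg* (ℚ.<⇒≤ 0<q) 0≤r)))))
  where
  0≤r = ℚ.≤-trans (ℚ.<⇒≤ 0<q) q≤r
  expand : ∀ a q r → (1ℚ + q) * (r * r + a * (1ℚ + r)) ≡ (1ℚ + r) * (q * q + a * (1ℚ + q)) + (r - q) * (r + q + q * r)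
  expand = solve-∀ ℚ-ring

cube-θ-σ₃ : ∀ a s → cube (θ a s) - σ₃ a (cube s) ≡ 3ℚ * θ a s * (s * L a s)
cube-θ-σ₃ a s = identity a s
  where
  identity : ∀ a s → let t = a + s + s * s ; b = s * s * s in
    t * t * t - (a * a * a + b - 3ℚ * a * b + b * b) ≡ 3ℚ * t * (s * (s * s + a * (1ℚ + s)))
  identity = solve-∀ ℚ-ring

σ₃-nonNeg : ∀ a s → 0ℚ ≤ θ a s → 0ℚ ≤ σ₃ a (cube s)
σ₃-nonNeg a s 0≤θ = nonNeg*⇒nonNeg (ℚ.positive⁻¹ 4ℚ) (subst (0ℚ ≤_) (sym (identity a s))
  (nonNeg* 0≤θ (nonNeg+ (square-nonNeg (a + a - s - s * s))
                        (nonNeg* (ℚ.<⇒≤ (ℚ.positive⁻¹ 3ℚ)) (square-nonNeg (s - s * s))))))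
  where
  identity : ∀ a s → let t = a + s + s * s ; b = s * s * s in
    4ℚ * (a * a * a + b - 3ℚ * a * b + b * b)
      ≡ t * ((a + a - s - s * s) * (a + a - s - s * s) + 3ℚ * ((s - s * s) * (s - s * s)))
  identity = solve-∀ ℚ-ring

sL-bound : ∀ a {q s} → 0ℚ ≤ q → q ≤ s → 0ℚ ≤ L a q → q * L a q ≤ (1ℚ + q) * (s * L a s)
sL-bound a {q} {s} 0≤q q≤s 0≤L = ≤-by-diff _ (expand a q s)
  (nonNeg+ (nonNeg+ (nonNeg* 0≤s-q 0≤L) (nonNeg* (square-nonNeg s) 0≤L))
           (nonNeg* 0≤s (nonNeg* 0≤s-q (nonNeg+ (nonNeg+ 0≤s 0≤q) (nonNeg* 0≤s 0≤q)))))
  where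
  0≤s = ℚ.≤-trans 0≤q q≤s
  0≤s-q = p≤q⇒0≤q-p q≤s
  expand : ∀ a q s → (1ℚ + q) * (s * (s * s + a * (1ℚ + s))) - q * (q * q + a * (1ℚ + q))
    ≡ (s - q) * (q * q + a * (1ℚ + q)) + s * s * (q * q + a * (1ℚ + q)) + s * ((s - q) * (s + q + s * q))
  expand = solve-∀ ℚ-ring

dominance-K : ℚ → ℚ → ℚ → ℚ
dominance-K a q A = (1ℚ + q) * (θ a A * θ a A)

dominance-H : ℚ → ℚ → ℚ
dominance-H a q = 3ℚ * q * L a q

dominance : ∀ {a q A s} → 0ℚ < q → 0ℚ < L a q → q ≤ s → s ≤ A →
  σ₃ a (cube s) * (dominance-K a q A + dominance-H a q) ≤ dominance-K a q A * cube (θ a s)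
dominance {a} {q} {A} {s} 0<q 0<L q≤s s≤A = begin
  σ₃ a (cube s) * (K + H)                ≡⟨ ℚ.*-distribˡ-+ (σ₃ a (cube s)) K H ⟩
  σ₃ a (cube s) * K + σ₃ a (cube s) * H  ≤⟨ ℚ.+-monoʳ-≤ (σ₃ a (cube s) * K) (*-monoʳ-≤ 0≤H σ₃≤θ³) ⟩
  σ₃ a (cube s) * K + cube (θ a s) * H   ≤⟨ ≤-by-diff _ (certificate a s q (θ a A)) certificate-nonNeg ⟩
  K * cube (θ a s)                       ∎
  where
  open ℚ.≤-Reasoning
  K = dominance-K a q A
  H = dominance-H a q
  0≤q = ℚ.<⇒≤ 0<q
  0≤s = ℚ.≤-trans 0≤q q≤s
  0≤H : 0ℚ ≤ H
  0≤H = nonNeg* (nonNeg* (ℚ.<⇒≤ (ℚ.positive⁻¹ 3ℚ)) 0≤q) (ℚ.<⇒≤ 0<L)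
  0≤θ : 0ℚ ≤ θ a s
  0≤θ = ℚ.≤-trans (ℚ.<⇒≤ (θ-pos a 0<q 0<L)) (θ-mono-≤ a 0≤q q≤s)
  qL≤[1+q]sL : q * L a q ≤ (1ℚ + q) * (s * L a s)
  qL≤[1+q]sL = sL-bound a 0≤q q≤s (ℚ.<⇒≤ 0<L)
  0≤sL : 0ℚ ≤ s * L a s
  0≤sL = nonNeg*⇒nonNeg (pos+ 0<1 0≤q) (ℚ.≤-trans (nonNeg* 0≤q (ℚ.<⇒≤ 0<L)) qL≤[1+q]sL)
  σ₃≤θ³ : σ₃ a (cube s) ≤ cube (θ a s)
  σ₃≤θ³ = ≤-by-diff _ (cube-θ-σ₃ a s) (nonNeg* (nonNeg* (ℚ.<⇒≤ (ℚ.positive⁻¹ 3ℚ)) 0≤θ) 0≤sL)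
  θ²≤T² : θ a s * θ a s ≤ θ a A * θ a A
  θ²≤T² = *-mono-≤ 0≤θ 0≤θ (θ-mono-≤ a 0≤s s≤A) (θ-mono-≤ a 0≤s s≤A)
  certificate : ∀ a s q T →
    let t = a + s + s * s
        b = s * s * s
        K = (1ℚ + q) * (T * T)
        H = 3ℚ * q * (q * q + a * (1ℚ + q))
        g = s * (s * s + a * (1ℚ + s))
    in K * (t * t * t) - ((a * a * a + b - 3ℚ * a * b + b * b) * K + t * t * t * H)
       ≡ 3ℚ * t * ((1ℚ + q) * g * (T * T - t * t) + t * t * ((1ℚ + q) * g - q * (q * q + a * (1ℚ + q))))
  certificate = solve-∀ ℚ-ring
  certificate-nonNeg : 0ℚ ≤ 3ℚ * θ a s * ((1ℚ + q) * (s * L a s) * (θ a A * θ a A - θ a s * θ a s)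
                                            + θ a s * θ a s * ((1ℚ + q) * (s * L a s) - q * L a q))
  certificate-nonNeg = nonNeg* (nonNeg* (ℚ.<⇒≤ (ℚ.positive⁻¹ 3ℚ)) 0≤θ)
    (nonNeg+ (nonNeg* (nonNeg* (nonNeg+ (ℚ.<⇒≤ 0<1) 0≤q) 0≤sL) (p≤q⇒0≤q-p θ²≤T²))
             (nonNeg* (square-nonNeg (θ a s)) (p≤q⇒0≤q-p qL≤[1+q]sL)))

dominance-K-pos : ∀ {a q A} → 0ℚ < q → 0ℚ < L a q → q ≤ A → 0ℚ < dominance-K a q A
dominance-K-pos {a} 0<q 0<L q≤A = pos* (pos+ 0<1 (ℚ.<⇒≤ 0<q)) (pos* 0<T 0<T)
  where
  0<T = ℚ.<-≤-trans (θ-pos a 0<q 0<L) (θ-mono-≤ a (ℚ.<⇒≤ 0<q) q≤A)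

dominance-gain : ∀ {a q A s} (0<K : 0ℚ < dominance-K a q A) → 0ℚ < q → 0ℚ < L a q → q ≤ s → s ≤ A →
  σ₃ a (cube s) * (1ℚ + dominance-H a q * 1/pos (dominance-K a q A) 0<K) ≤ cube (θ a s)
dominance-gain {a} {q} {A} {s} 0<K 0<q 0<L q≤s s≤A = *-cancelˡ-≤ 0<K (begin
  K * (σ₃ a (cube s) * (1ℚ + h))    ≡⟨ regroup K (σ₃ a (cube s)) h ⟩
  σ₃ a (cube s) * (K + K * h)       ≡⟨ cong (λ x → σ₃ a (cube s) * (K + x)) (*-1/pos-cancel K H 0<K) ⟩
  σ₃ a (cube s) * (K + H)           ≤⟨ dominance {a} 0<q 0<L q≤s s≤A ⟩
  K * cube (θ a s)                  ∎)
  where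
  open ℚ.≤-Reasoning
  K = dominance-K a q A
  H = dominance-H a q
  h = H * 1/pos K 0<K
  regroup : ∀ K σ h → K * (σ * (1ℚ + h)) ≡ σ * (K + K * h)
  regroup = solve-∀ ℚ-ring

cube-^ : ∀ p m → cube p ^ m ≡ cube (p ^ m)
cube-^ p m = trans (^-distrib-* (p * p) p m) (cong (_* p ^ m) (^-distrib-* p p m))

decay : ∀ {a q A δ} → 0ℚ < q → 0ℚ < L a q → q ≤ A → 0ℚ < δ →
  Σ ℕ λ N → ∀ m → N ℕ.≤ m → ∀ s → q ≤ s → s ≤ A → 4ℚ * σ₃ a (cube s) ^ m ≤ δ * cube (θ a s ^ m)
decay {a} {q} {A} {δ} 0<q 0<L q≤A 0<δ = N , bound
  where
  open ℚ.≤-Reasoning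
  0<K = dominance-K-pos {a} 0<q 0<L q≤A
  h = dominance-H a q * 1/pos (dominance-K a q A) 0<K
  0<h : 0ℚ < h
  0<h = pos* (pos* (pos* (ℚ.positive⁻¹ 3ℚ) 0<q) 0<L) (1/pos-pos _ 0<K)
  0<δh = pos* 0<δ 0<h
  N = proj₁ (archimedean (4ℚ * 1/pos (δ * h) 0<δh))
  4≤δhM : ∀ m → N ℕ.≤ m → 4ℚ ≤ δ * h * fromℤ (+ m)
  4≤δhM m N≤m = begin
    4ℚ                                       ≡⟨ sym (*-1/pos-cancel (δ * h) 4ℚ 0<δh) ⟩
    δ * h * (4ℚ * 1/pos (δ * h) 0<δh)         ≤⟨ *-monoˡ-≤ (ℚ.<⇒≤ 0<δh) (proj₂ (archimedean _)) ⟩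
    δ * h * fromℤ (+ N)                      ≤⟨ *-monoˡ-≤ (ℚ.<⇒≤ 0<δh) (fromℤ-mono-≤ (ℤ.+≤+ N≤m)) ⟩
    δ * h * fromℤ (+ m)                      ∎
  bound : ∀ m → N ℕ.≤ m → ∀ s → q ≤ s → s ≤ A → 4ℚ * σ₃ a (cube s) ^ m ≤ δ * cube (θ a s ^ m)
  bound m N≤m s q≤s s≤A = begin
    4ℚ * σ ^ m                      ≤⟨ *-monoʳ-≤ 0≤σ^m (ℚ.≤-trans (4≤δhM m N≤m)
                                          (≤-by-diff {q = δ * (1ℚ + M * h)} δ (slack δ h M) (ℚ.<⇒≤ 0<δ))) ⟩
    δ * (1ℚ + M * h) * σ ^ m        ≤⟨ *-monoʳ-≤ 0≤σ^m (*-monoˡ-≤ (ℚ.<⇒≤ 0<δ) (bernoulli m (ℚ.<⇒≤ 0<h))) ⟩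
    δ * (1ℚ + h) ^ m * σ ^ m        ≡⟨ regroup δ ((1ℚ + h) ^ m) (σ ^ m) ⟩
    δ * (σ ^ m * (1ℚ + h) ^ m)      ≡⟨ cong (δ *_) (sym (^-distrib-* σ (1ℚ + h) m)) ⟩
    δ * (σ * (1ℚ + h)) ^ m          ≤⟨ *-monoˡ-≤ (ℚ.<⇒≤ 0<δ)
                                          (^-mono-≤ m 0≤σ[1+h] (dominance-gain {a} 0<K 0<q 0<L q≤s s≤A)) ⟩
    δ * cube (θ a s) ^ m            ≡⟨ cong (δ *_) (cube-^ (θ a s) m) ⟩
    δ * cube (θ a s ^ m)            ∎
    where
    M = fromℤ (+ m)
    σ = σ₃ a (cube s)
    0≤σ : 0ℚ ≤ σ
    0≤σ = σ₃-nonNeg a s (ℚ.≤-trans (ℚ.<⇒≤ (θ-pos a 0<q 0<L)) (θ-mono-≤ a (ℚ.<⇒≤ 0<q) q≤s))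
    0≤σ^m = ^-nonNeg m 0≤σ
    0≤σ[1+h] = nonNeg* 0≤σ (nonNeg+ (ℚ.<⇒≤ 0<1) (ℚ.<⇒≤ 0<h))
    slack : ∀ δ h M → δ * (1ℚ + M * h) - δ * h * M ≡ δ
    slack = solve-∀ ℚ-ring
    regroup : ∀ d X Y → d * X * Y ≡ d * (Y * X)
    regroup = solve-∀ ℚ-ring

estimate-at : ∀ {a q A ζ} m s → 0ℚ < q → 0ℚ < L a q → q ≤ s → s ≤ A → 0ℚ ≤ ζ → ζ ≤ ½ →
  4ℚ * σ₃ a (cube s) ^ m ≤ ζ * ζ * cube (θ a s ^ m) → let v = powU a (cube s) m in
  θ a q ^ m ≤ 6ℚ * (A * A) * c₂ v × ∣ c₁ v - s * c₂ v ∣ ≤ 4ℚ * ζ * A * c₂ v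
estimate-at {a} {q} {A} {ζ} m s 0<q 0<L q≤s s≤A 0≤ζ ζ≤½ decayed = lower , approximation
  where
  open ℚ.≤-Reasoning
  v = powU a (cube s) m
  z = c₂ v
  0≤q = ℚ.<⇒≤ 0<q
  0<s = ℚ.<-≤-trans 0<q q≤s
  0≤s = ℚ.<⇒≤ 0<s
  0<X : 0ℚ < evalAt s v
  0<X = subst (0ℚ <_) (sym (evalAt-powU a s m)) (^-pos m (ℚ.<-≤-trans (θ-pos a 0<q 0<L) (θ-mono-≤ a 0≤q q≤s)))
  small : 4ℚ * norm (cube s) v ≤ ζ * ζ * cube (evalAt s v)
  small = subst₂ (λ x y → 4ℚ * x ≤ ζ * ζ * cube y) (sym (norm-powU a (cube s) m)) (sym (evalAt-powU a s m)) decayed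
  eigen = near-eigenvector v 0<s 0≤ζ ζ≤½ 0<X small
  0≤z : 0ℚ ≤ z
  0≤z = ℚ.<⇒≤ (pos*⇒pos (pos* (ℚ.positive⁻¹ 6ℚ) (pos* 0<s 0<s)) (ℚ.<-≤-trans 0<X (proj₁ eigen)))
  lower : θ a q ^ m ≤ 6ℚ * (A * A) * z
  lower = begin
    θ a q ^ m               ≤⟨ ^-mono-≤ m (ℚ.<⇒≤ (θ-pos a 0<q 0<L)) (θ-mono-≤ a 0≤q q≤s) ⟩
    θ a s ^ m               ≡⟨ sym (evalAt-powU a s m) ⟩
    evalAt s v              ≤⟨ proj₁ eigen ⟩
    6ℚ * (s * s) * z        ≤⟨ *-monoʳ-≤ 0≤z (*-monoˡ-≤ (ℚ.<⇒≤ (ℚ.positive⁻¹ 6ℚ)) (*-mono-≤ 0≤s 0≤s s≤A s≤A)) ⟩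
    6ℚ * (A * A) * z        ∎
  approximation : ∣ c₁ v - s * z ∣ ≤ 4ℚ * ζ * A * z
  approximation = ℚ.≤-trans (proj₂ eigen)
    (*-monoʳ-≤ 0≤z (*-monoˡ-≤ (nonNeg* (ℚ.<⇒≤ (ℚ.positive⁻¹ 4ℚ)) 0≤ζ) s≤A))

uniform-estimate : ∀ {a q A e} → 0ℚ < q → 0ℚ < L a q → q ≤ A → 0ℚ < e →
  Σ ℕ λ N → ∀ m → N ℕ.≤ m → ∀ s → q ≤ s → s ≤ A → let v = powU a (cube s) m in
    θ a q ^ m ≤ 6ℚ * (A * A) * c₂ v × ∣ c₁ v - s * c₂ v ∣ ≤ e * c₂ v
uniform-estimate {a} {q} {A} {e} 0<q 0<L q≤A 0<e = proj₁ decayed , estimate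
  where
  open ℚ.≤-Reasoning
  0<4A = pos* (ℚ.positive⁻¹ 4ℚ) (ℚ.<-≤-trans 0<q q≤A)
  ζ = e * 1/pos (4ℚ * A) 0<4A ⊓ ½
  0<ζ : 0ℚ < ζ
  0<ζ = ⊓-pos (pos* 0<e (1/pos-pos (4ℚ * A) 0<4A)) (ℚ.positive⁻¹ ½)
  4ζA≤e : 4ℚ * ζ * A ≤ e
  4ζA≤e = begin
    4ℚ * ζ * A                                 ≡⟨ regroup 4ℚ ζ A ⟩
    (4ℚ * A) * ζ                               ≤⟨ *-monoˡ-≤ (ℚ.<⇒≤ 0<4A) (ℚ.p⊓q≤p (e * 1/pos (4ℚ * A) 0<4A) ½) ⟩
    (4ℚ * A) * (e * 1/pos (4ℚ * A) 0<4A)        ≡⟨ *-1/pos-cancel (4ℚ * A) e 0<4A ⟩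
    e                                          ∎
    where
    regroup : ∀ f z A → f * z * A ≡ (f * A) * z
    regroup = solve-∀ ℚ-ring
  decayed = decay {a} {δ = ζ * ζ} 0<q 0<L q≤A (pos* 0<ζ 0<ζ)
  estimate : ∀ m → proj₁ decayed ℕ.≤ m → ∀ s → q ≤ s → s ≤ A → let v = powU a (cube s) m in
    θ a q ^ m ≤ 6ℚ * (A * A) * c₂ v × ∣ c₁ v - s * c₂ v ∣ ≤ e * c₂ v
  estimate m N≤m s q≤s s≤A = proj₁ at-s , ℚ.≤-trans (proj₂ at-s) (*-monoʳ-≤ 0≤z 4ζA≤e)
    where
    at-s = estimate-at {a} {q} {A} m s 0<q 0<L q≤s s≤A (ℚ.<⇒≤ 0<ζ) (ℚ.p⊓q≤q (e * 1/pos (4ℚ * A) 0<4A) ½)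
                       (proj₂ decayed m N≤m s q≤s s≤A)
    0<A = ℚ.<-≤-trans 0<q q≤A
    0≤z = ℚ.<⇒≤ (pos*⇒pos (pos* (ℚ.positive⁻¹ 6ℚ) (pos* 0<A 0<A))
                          (ℚ.<-≤-trans (^-pos m (θ-pos a 0<q 0<L)) (proj₁ at-s)))

-- Dependence on b

size : Cubic → ℚ
size v = ∣ c₀ v ∣ + ∣ c₁ v ∣ + ∣ c₂ v ∣

dist : Cubic → Cubic → ℚ
dist v w = ∣ c₀ v - c₀ w ∣ + ∣ c₁ v - c₁ w ∣ + ∣ c₂ v - c₂ w ∣

∣*∣≤ : ∀ p x → ∣ p * x ∣ ≤ ∣ p ∣ * ∣ x ∣
∣*∣≤ p x = ℚ.≤-reflexive (ℚ.∣p*q∣≡∣p∣*∣q∣ p x)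

∣lin₃∣≤ : ∀ p q r x y z → ∣ p * x + q * y + r * z ∣ ≤ ∣ p ∣ * ∣ x ∣ + ∣ q ∣ * ∣ y ∣ + ∣ r ∣ * ∣ z ∣
∣lin₃∣≤ p q r x y z = ℚ.≤-trans (ℚ.∣p+q∣≤∣p∣+∣q∣ (p * x + q * y) (r * z))
  (ℚ.+-mono-≤ (ℚ.≤-trans (ℚ.∣p+q∣≤∣p∣+∣q∣ (p * x) (q * y)) (ℚ.+-mono-≤ (∣*∣≤ p x) (∣*∣≤ q y))) (∣*∣≤ r z))

∣lin₃+∣≤ : ∀ p q r x y z t → ∣ p * x + q * y + r * z + t ∣ ≤ ∣ p ∣ * ∣ x ∣ + ∣ q ∣ * ∣ y ∣ + ∣ r ∣ * ∣ z ∣ + ∣ t ∣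
∣lin₃+∣≤ p q r x y z t =
  ℚ.≤-trans (ℚ.∣p+q∣≤∣p∣+∣q∣ (p * x + q * y + r * z) t) (ℚ.+-mono-≤ (∣lin₃∣≤ p q r x y z) ℚ.≤-refl)

growth : ℚ → ℚ → ℚ
growth a B = ∣ a ∣ + 2ℚ * B + 2ℚ

growth-nonNeg : ∀ a {B} → 0ℚ ≤ B → 0ℚ ≤ growth a B
growth-nonNeg a 0≤B = nonNeg+ (nonNeg+ (ℚ.0≤∣p∣ a) (nonNeg* (ℚ.<⇒≤ (ℚ.positive⁻¹ 2ℚ)) 0≤B)) (ℚ.<⇒≤ (ℚ.positive⁻¹ 2ℚ))

size-mulU : ∀ a {b B} v → ∣ b ∣ ≤ B → size (mulU a b v) ≤ growth a B * size v
size-mulU a {b} {B} v ∣b∣≤B = begin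
  size (mulU a b v)
    ≡⟨ cong₂ (λ u w → ∣ a * x + b * y + b * z ∣ + ∣ u ∣ + ∣ w ∣) (unit₁ a b x y z) (unit₂ a x y z) ⟩
  ∣ a * x + b * y + b * z ∣ + ∣ 1ℚ * x + a * y + b * z ∣ + ∣ 1ℚ * x + 1ℚ * y + a * z ∣
    ≤⟨ ℚ.+-mono-≤ (ℚ.+-mono-≤ (∣lin₃∣≤ a b b x y z) (∣lin₃∣≤ 1ℚ a b x y z)) (∣lin₃∣≤ 1ℚ 1ℚ a x y z) ⟩
  (∣ a ∣ * ∣ x ∣ + ∣ b ∣ * ∣ y ∣ + ∣ b ∣ * ∣ z ∣) + (1ℚ * ∣ x ∣ + ∣ a ∣ * ∣ y ∣ + ∣ b ∣ * ∣ z ∣)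
    + (1ℚ * ∣ x ∣ + 1ℚ * ∣ y ∣ + ∣ a ∣ * ∣ z ∣)
    ≤⟨ ≤-by-diff _ (slack (∣ a ∣) (∣ b ∣) B (∣ x ∣) (∣ y ∣) (∣ z ∣))
         (nonNeg+ (nonNeg+ (nonNeg* (nonNeg* 0≤2 0≤B) (ℚ.0≤∣p∣ x))
                           (nonNeg* (nonNeg+ (nonNeg+ 0≤B-∣b∣ 0≤B) (ℚ.<⇒≤ 0<1)) (ℚ.0≤∣p∣ y)))
                  (nonNeg* (nonNeg+ (nonNeg* 0≤2 0≤B-∣b∣) 0≤2) (ℚ.0≤∣p∣ z))) ⟩
  growth a B * size v ∎
  where
  open ℚ.≤-Reasoning
  x = c₀ v
  y = c₁ v
  z = c₂ v
  0≤2 = ℚ.<⇒≤ (ℚ.positive⁻¹ 2ℚ)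
  0≤B-∣b∣ = p≤q⇒0≤q-p ∣b∣≤B
  0≤B = ℚ.≤-trans (ℚ.0≤∣p∣ b) ∣b∣≤B
  unit₁ : ∀ a b x y z → x + a * y + b * z ≡ 1ℚ * x + a * y + b * z
  unit₁ = solve-∀ ℚ-ring
  unit₂ : ∀ a x y z → x + y + a * z ≡ 1ℚ * x + 1ℚ * y + a * z
  unit₂ = solve-∀ ℚ-ring
  slack : ∀ A b B X Y Z →
    (A + 2ℚ * B + 2ℚ) * (X + Y + Z)
      - ((A * X + b * Y + b * Z) + (1ℚ * X + A * Y + b * Z) + (1ℚ * X + 1ℚ * Y + A * Z))
    ≡ 2ℚ * B * X + ((B - b) + B + 1ℚ) * Y + (2ℚ * (B - b) + 2ℚ) * Z
  slack = solve-∀ ℚ-ring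

dist-mulU : ∀ a {b b′ B} v w → ∣ b ∣ ≤ B →
  dist (mulU a b v) (mulU a b′ w) ≤ growth a B * dist v w + 2ℚ * ∣ b - b′ ∣ * size w
dist-mulU a {b} {b′} {B} v w ∣b∣≤B = begin
  dist (mulU a b v) (mulU a b′ w)
    ≡⟨ cong₂ (λ u t → ∣ u ∣ + ∣ t ∣ + ∣ Δ₂ ∣) (split₀ a b b′ x y z x′ y′ z′) (split₁ a b b′ x y z x′ y′ z′) ⟩
  ∣ a * dx + b * dy + b * dz + β * (y′ + z′) ∣ + ∣ 1ℚ * dx + a * dy + b * dz + β * z′ ∣ + ∣ Δ₂ ∣
    ≡⟨ cong (λ u → ∣ a * dx + b * dy + b * dz + β * (y′ + z′) ∣ + ∣ 1ℚ * dx + a * dy + b * dz + β * z′ ∣ + ∣ u ∣)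
            (split₂ a x y z x′ y′ z′) ⟩
  ∣ a * dx + b * dy + b * dz + β * (y′ + z′) ∣ + ∣ 1ℚ * dx + a * dy + b * dz + β * z′ ∣
    + ∣ 1ℚ * dx + 1ℚ * dy + a * dz ∣
    ≤⟨ ℚ.+-mono-≤ (ℚ.+-mono-≤ (ℚ.≤-trans (∣lin₃+∣≤ a b b dx dy dz (β * (y′ + z′)))
                                         (ℚ.+-monoʳ-≤ (∣ a ∣ * ∣ dx ∣ + ∣ b ∣ * ∣ dy ∣ + ∣ b ∣ * ∣ dz ∣)
                                                      (ℚ.≤-trans (∣*∣≤ β (y′ + z′))
                                                           (*-monoˡ-≤ (ℚ.0≤∣p∣ β) (ℚ.∣p+q∣≤∣p∣+∣q∣ y′ z′)))))
                              (ℚ.≤-trans (∣lin₃+∣≤ 1ℚ a b dx dy dz (β * z′))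
                                         (ℚ.+-monoʳ-≤ (∣ 1ℚ ∣ * ∣ dx ∣ + ∣ a ∣ * ∣ dy ∣ + ∣ b ∣ * ∣ dz ∣) (∣*∣≤ β z′))))
                  (∣lin₃∣≤ 1ℚ 1ℚ a dx dy dz) ⟩
  (∣ a ∣ * ∣ dx ∣ + ∣ b ∣ * ∣ dy ∣ + ∣ b ∣ * ∣ dz ∣ + ∣ β ∣ * (∣ y′ ∣ + ∣ z′ ∣))
    + (1ℚ * ∣ dx ∣ + ∣ a ∣ * ∣ dy ∣ + ∣ b ∣ * ∣ dz ∣ + ∣ β ∣ * ∣ z′ ∣)
    + (1ℚ * ∣ dx ∣ + 1ℚ * ∣ dy ∣ + ∣ a ∣ * ∣ dz ∣)
    ≤⟨ ≤-by-diff _ (slack (∣ a ∣) (∣ b ∣) B (∣ dx ∣) (∣ dy ∣) (∣ dz ∣) (∣ β ∣) (∣ x′ ∣) (∣ y′ ∣) (∣ z′ ∣))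
         (nonNeg+ (nonNeg+ (nonNeg+ (nonNeg* (nonNeg* 0≤2 0≤B) (ℚ.0≤∣p∣ dx))
                                    (nonNeg* (nonNeg+ (nonNeg+ 0≤B-∣b∣ 0≤B) (ℚ.<⇒≤ 0<1)) (ℚ.0≤∣p∣ dy)))
                           (nonNeg* (nonNeg+ (nonNeg* 0≤2 0≤B-∣b∣) 0≤2) (ℚ.0≤∣p∣ dz)))
                  (nonNeg* (ℚ.0≤∣p∣ β) (nonNeg+ (nonNeg* 0≤2 (ℚ.0≤∣p∣ x′)) (ℚ.0≤∣p∣ y′)))) ⟩
  growth a B * dist v w + 2ℚ * ∣ β ∣ * size w ∎
  where
  open ℚ.≤-Reasoning
  x = c₀ v
  y = c₁ v
  z = c₂ v
  x′ = c₀ w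
  y′ = c₁ w
  z′ = c₂ w
  dx = x - x′
  dy = y - y′
  dz = z - z′
  β = b - b′
  Δ₂ = c₂ (mulU a b v) - c₂ (mulU a b′ w)
  0≤2 = ℚ.<⇒≤ (ℚ.positive⁻¹ 2ℚ)
  0≤B-∣b∣ = p≤q⇒0≤q-p ∣b∣≤B
  0≤B = ℚ.≤-trans (ℚ.0≤∣p∣ b) ∣b∣≤B
  split₀ : ∀ a b b′ x y z x′ y′ z′ → (a * x + b * y + b * z) - (a * x′ + b′ * y′ + b′ * z′)
    ≡ a * (x - x′) + b * (y - y′) + b * (z - z′) + (b - b′) * (y′ + z′)
  split₀ = solve-∀ ℚ-ring
  split₁ : ∀ a b b′ x y z x′ y′ z′ → (x + a * y + b * z) - (x′ + a * y′ + b′ * z′)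
    ≡ 1ℚ * (x - x′) + a * (y - y′) + b * (z - z′) + (b - b′) * z′
  split₁ = solve-∀ ℚ-ring
  split₂ : ∀ a x y z x′ y′ z′ → (x + y + a * z) - (x′ + y′ + a * z′) ≡ 1ℚ * (x - x′) + 1ℚ * (y - y′) + a * (z - z′)
  split₂ = solve-∀ ℚ-ring
  slack : ∀ A b B X Y Z β X′ Y′ Z′ →
    (A + 2ℚ * B + 2ℚ) * (X + Y + Z) + 2ℚ * β * (X′ + Y′ + Z′)
      - ((A * X + b * Y + b * Z + β * (Y′ + Z′)) + (1ℚ * X + A * Y + b * Z + β * Z′) + (1ℚ * X + 1ℚ * Y + A * Z))
    ≡ 2ℚ * B * X + ((B - b) + B + 1ℚ) * Y + (2ℚ * (B - b) + 2ℚ) * Z + β * (2ℚ * X′ + Y′)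
  slack = solve-∀ ℚ-ring

size-powU : ∀ a {b B} m → ∣ b ∣ ≤ B → size (powU a b m) ≤ growth a B ^ m
size-powU a zero    _     = ℚ.≤-refl
size-powU a {b} {B} (suc m) ∣b∣≤B = ℚ.≤-trans (size-mulU a (powU a b m) ∣b∣≤B)
  (*-monoˡ-≤ (growth-nonNeg a (ℚ.≤-trans (ℚ.0≤∣p∣ b) ∣b∣≤B)) (size-powU a m ∣b∣≤B))

lipschitz-constant : ℚ → ℚ → ℕ → ℚ
lipschitz-constant a B zero    = 0ℚ
lipschitz-constant a B (suc m) = growth a B * lipschitz-constant a B m + 2ℚ * growth a B ^ m

lipschitz-constant-nonNeg : ∀ a {B} m → 0ℚ ≤ B → 0ℚ ≤ lipschitz-constant a B m
lipschitz-constant-nonNeg a zero    0≤B = ℚ.≤-refl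
lipschitz-constant-nonNeg a (suc m) 0≤B =
  nonNeg+ (nonNeg* (growth-nonNeg a 0≤B) (lipschitz-constant-nonNeg a m 0≤B))
          (nonNeg* (ℚ.<⇒≤ (ℚ.positive⁻¹ 2ℚ)) (^-nonNeg m (growth-nonNeg a 0≤B)))

dist-powU : ∀ a {b b′ B} m → ∣ b ∣ ≤ B → ∣ b′ ∣ ≤ B →
  dist (powU a b m) (powU a b′ m) ≤ lipschitz-constant a B m * ∣ b - b′ ∣
dist-powU a {b} {b′} {B} zero _ _ = ℚ.≤-reflexive (trans (zero-dist) (sym (ℚ.*-zeroˡ ∣ b - b′ ∣)))
  where
  zero-dist : ∣ 1ℚ - 1ℚ ∣ + ∣ 0ℚ - 0ℚ ∣ + ∣ 0ℚ - 0ℚ ∣ ≡ 0ℚ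
  zero-dist = refl
dist-powU a {b} {b′} {B} (suc m) ∣b∣≤B ∣b′∣≤B = begin
  dist (mulU a b (powU a b m)) (mulU a b′ (powU a b′ m))
    ≤⟨ dist-mulU a (powU a b m) (powU a b′ m) ∣b∣≤B ⟩
  K * dist (powU a b m) (powU a b′ m) + 2ℚ * ∣ b - b′ ∣ * size (powU a b′ m)
    ≤⟨ ℚ.+-mono-≤ (*-monoˡ-≤ 0≤K (dist-powU a m ∣b∣≤B ∣b′∣≤B))
                  (*-monoˡ-≤ (nonNeg* (ℚ.<⇒≤ (ℚ.positive⁻¹ 2ℚ)) (ℚ.0≤∣p∣ (b - b′))) (size-powU a m ∣b′∣≤B)) ⟩
  K * (lipschitz-constant a B m * ∣ b - b′ ∣) + 2ℚ * ∣ b - b′ ∣ * K ^ m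
    ≡⟨ regroup K (lipschitz-constant a B m) (∣ b - b′ ∣) (K ^ m) ⟩
  lipschitz-constant a B (suc m) * ∣ b - b′ ∣ ∎
  where
  open ℚ.≤-Reasoning
  K = growth a B
  0≤K = growth-nonNeg a (ℚ.≤-trans (ℚ.0≤∣p∣ b) ∣b∣≤B)
  regroup : ∀ K l β P → K * (l * β) + 2ℚ * β * P ≡ (K * l + 2ℚ * P) * β
  regroup = solve-∀ ℚ-ring

-- Rational cube roots by bisection

record CubeRootBracket (A : ℚ) : Set where
  field
    lo hi   : ℚ
    1≤lo    : 1ℚ ≤ lo
    lo≤hi   : lo ≤ hi
    hi≤A    : hi ≤ A
    lo³≤A   : cube lo ≤ A
    A≤hi³   : A ≤ cube hi
open CubeRootBracket

width : ∀ {A} → CubeRootBracket A → ℚ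
width br = hi br - lo br

initial : ∀ {A} → 1ℚ ≤ A → CubeRootBracket A
initial {A} 1≤A = record
  { lo = 1ℚ ; hi = A ; 1≤lo = ℚ.≤-refl ; lo≤hi = 1≤A ; hi≤A = ℚ.≤-refl ; lo³≤A = 1≤A
  ; A≤hi³ = p≤cube-p 1≤A }

midpoint : ℚ → ℚ → ℚ
midpoint p q = (p + q) * ½

midpoint-lo : ∀ p q → (p + q) * ½ - p ≡ (q - p) * ½
midpoint-lo = solve-∀ ℚ-ring

midpoint-hi : ∀ p q → q - (p + q) * ½ ≡ (q - p) * ½
midpoint-hi = solve-∀ ℚ-ring

halve : ∀ {A} → CubeRootBracket A → CubeRootBracket A
halve {A} br with cube (midpoint (lo br) (hi br)) ℚ.≤? A
... | yes m³≤A = record br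
  { lo = midpoint (lo br) (hi br) ; 1≤lo = ℚ.≤-trans (1≤lo br) lo≤m ; lo≤hi = m≤hi ; lo³≤A = m³≤A }
  where
  0≤half-width = nonNeg* (p≤q⇒0≤q-p (lo≤hi br)) (ℚ.<⇒≤ (ℚ.positive⁻¹ ½))
  lo≤m = ≤-by-diff _ (midpoint-lo (lo br) (hi br)) 0≤half-width
  m≤hi = ≤-by-diff _ (midpoint-hi (lo br) (hi br)) 0≤half-width
... | no  m³≰A = record br
  { hi = midpoint (lo br) (hi br) ; lo≤hi = lo≤m ; hi≤A = ℚ.≤-trans m≤hi (hi≤A br) ; A≤hi³ = ℚ.<⇒≤ (ℚ.≰⇒> m³≰A) }
  where
  0≤half-width = nonNeg* (p≤q⇒0≤q-p (lo≤hi br)) (ℚ.<⇒≤ (ℚ.positive⁻¹ ½))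
  lo≤m = ≤-by-diff _ (midpoint-lo (lo br) (hi br)) 0≤half-width
  m≤hi = ≤-by-diff _ (midpoint-hi (lo br) (hi br)) 0≤half-width

width-halve : ∀ {A} (br : CubeRootBracket A) → width (halve br) ≡ width br * ½
width-halve {A} br with cube (midpoint (lo br) (hi br)) ℚ.≤? A
... | yes _ = midpoint-hi (lo br) (hi br)
... | no  _ = midpoint-lo (lo br) (hi br)

bisection : ∀ {A} → 1ℚ ≤ A → ℕ → CubeRootBracket A
bisection 1≤A zero    = initial 1≤A
bisection 1≤A (suc k) = halve (bisection 1≤A k)

width-bisection : ∀ {A} (1≤A : 1ℚ ≤ A) k → width (bisection 1≤A k) ≡ (A - 1ℚ) * ½ ^ k
width-bisection {A} 1≤A zero    = sym (ℚ.*-identityʳ (A - 1ℚ))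
width-bisection {A} 1≤A (suc k) = begin
  width (halve (bisection 1≤A k))   ≡⟨ width-halve (bisection 1≤A k) ⟩
  width (bisection 1≤A k) * ½       ≡⟨ cong (_* ½) (width-bisection 1≤A k) ⟩
  (A - 1ℚ) * ½ ^ k * ½              ≡⟨ regroup (A - 1ℚ) (½ ^ k) ⟩
  (A - 1ℚ) * ½ ^ suc k              ∎
  where
  open ≡-Reasoning
  regroup : ∀ w p → w * p * ½ ≡ w * (½ * p)
  regroup = solve-∀ ℚ-ring

cube-gap : ∀ {A} (br : CubeRootBracket A) → cube (hi br) - cube (lo br) ≤ width br * (3ℚ * (A * A))
cube-gap {A} br = begin
  cube h - cube l                 ≡⟨ factor h l ⟩
  (h - l) * (h * h + h * l + l * l) ≤⟨ *-monoˡ-≤ (p≤q⇒0≤q-p (lo≤hi br)) (≤-by-diff _ (slack A h l)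
                                        (nonNeg+ (nonNeg+ (p≤q⇒0≤q-p (*-mono-≤ 0≤h 0≤h (hi≤A br) (hi≤A br)))
                                                          (p≤q⇒0≤q-p (*-mono-≤ 0≤h 0≤l (hi≤A br) l≤A)))
                                                 (p≤q⇒0≤q-p (*-mono-≤ 0≤l 0≤l l≤A l≤A)))) ⟩
  (h - l) * (3ℚ * (A * A))         ∎
  where
  open ℚ.≤-Reasoning
  h = hi br
  l = lo br
  0≤l = ℚ.≤-trans (ℚ.<⇒≤ 0<1) (1≤lo br)
  0≤h = ℚ.≤-trans 0≤l (lo≤hi br)
  l≤A = ℚ.≤-trans (lo≤hi br) (hi≤A br)
  factor : ∀ h l → h * h * h - l * l * l ≡ (h - l) * (h * h + h * l + l * l)
  factor = solve-∀ ℚ-ring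
  slack : ∀ A h l → 3ℚ * (A * A) - (h * h + h * l + l * l) ≡ (A * A - h * h) + (A * A - h * l) + (A * A - l * l)
  slack = solve-∀ ℚ-ring

½^k[1+k]≤1 : ∀ k → ½ ^ k * (1ℚ + fromℤ (+ k)) ≤ 1ℚ
½^k[1+k]≤1 k = begin
  ½ ^ k * (1ℚ + fromℤ (+ k))         ≡⟨ cong (λ x → ½ ^ k * (1ℚ + x)) (sym (ℚ.*-identityʳ (fromℤ (+ k)))) ⟩
  ½ ^ k * (1ℚ + fromℤ (+ k) * 1ℚ)    ≤⟨ *-monoˡ-≤ (^-nonNeg k (ℚ.<⇒≤ (ℚ.positive⁻¹ ½))) (bernoulli k (ℚ.<⇒≤ 0<1)) ⟩
  ½ ^ k * 2ℚ ^ k                     ≡⟨ sym (^-distrib-* ½ 2ℚ k) ⟩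
  1ℚ ^ k                             ≡⟨ 1^k≡1 k ⟩
  1ℚ                                 ∎
  where
  open ℚ.≤-Reasoning
  1^k≡1 : ∀ k → 1ℚ ^ k ≡ 1ℚ
  1^k≡1 zero    = refl
  1^k≡1 (suc k) = trans (ℚ.*-identityˡ (1ℚ ^ k)) (1^k≡1 k)

cube-root-bracket : ∀ {A η} → 1ℚ ≤ A → 0ℚ < η → Σ (CubeRootBracket A) λ br → cube (hi br) - cube (lo br) ≤ η
cube-root-bracket {A} {η} 1≤A 0<η = bisection 1≤A k , (begin
  cube (hi br) - cube (lo br)        ≤⟨ cube-gap br ⟩
  width br * (3ℚ * (A * A))          ≡⟨ cong (_* (3ℚ * (A * A))) (width-bisection 1≤A k) ⟩
  (A - 1ℚ) * ½ ^ k * (3ℚ * (A * A))  ≡⟨ regroup (A - 1ℚ) (½ ^ k) (3ℚ * (A * A)) ⟩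
  C * ½ ^ k                          ≤⟨ *-monoʳ-≤ 0≤½^k C≤ηk ⟩
  η * K * ½ ^ k                      ≤⟨ ≤-by-diff _ (slack η K (½ ^ k)) (nonNeg* (ℚ.<⇒≤ 0<η) 0≤½^k) ⟩
  η * (½ ^ k * (1ℚ + K))             ≤⟨ *-monoˡ-≤ (ℚ.<⇒≤ 0<η) (½^k[1+k]≤1 k) ⟩
  η * 1ℚ                             ≡⟨ ℚ.*-identityʳ η ⟩
  η                                  ∎)
  where
  open ℚ.≤-Reasoning
  C = (A - 1ℚ) * (3ℚ * (A * A))
  k = proj₁ (archimedean (C * 1/pos η 0<η))
  K = fromℤ (+ k)
  br = bisection 1≤A k
  0≤½^k = ^-nonNeg k (ℚ.<⇒≤ (ℚ.positive⁻¹ ½))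
  C≤ηk : C ≤ η * K
  C≤ηk = begin
    C                              ≡⟨ sym (*-1/pos-cancel η C 0<η) ⟩
    η * (C * 1/pos η 0<η)           ≤⟨ *-monoˡ-≤ (ℚ.<⇒≤ 0<η) (proj₂ (archimedean (C * 1/pos η 0<η))) ⟩
    η * K                          ∎
  regroup : ∀ w p T → w * p * T ≡ w * T * p
  regroup = solve-∀ ℚ-ring
  slack : ∀ η K p → η * (p * (1ℚ + K)) - η * K * p ≡ η * p
  slack = solve-∀ ℚ-ring

close-bracket : ∀ {A q η} → 1ℚ ≤ A → cube q < A → 0ℚ < η → η ≤ (A - cube q) * ½ →
  Σ (CubeRootBracket A) λ br → q ≤ lo br × ∣ cube (lo br) - A ∣ ≤ η × ∣ cube (hi br) - A ∣ ≤ η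
close-bracket {A} {q} {η} 1≤A q³<A 0<η η≤gap = br , q≤lo , near-lo , near-hi
  where
  br = proj₁ (cube-root-bracket 1≤A 0<η)
  hi³-lo³≤η = proj₂ (cube-root-bracket 1≤A 0<η)
  A-lo³≤η : A - cube (lo br) ≤ η
  A-lo³≤η = ℚ.≤-trans (ℚ.+-monoˡ-≤ (- cube (lo br)) (A≤hi³ br)) hi³-lo³≤η
  near-lo : ∣ cube (lo br) - A ∣ ≤ η
  near-lo = -q≤p≤q⇒∣p∣≤q (≤-by-diff _ (flip₁ (cube (lo br)) A η) (p≤q⇒0≤q-p A-lo³≤η))
                         (≤-by-diff _ (flip₂ (cube (lo br)) A η) (nonNeg+ (ℚ.<⇒≤ 0<η) (p≤q⇒0≤q-p (lo³≤A br))))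
    where
    flip₁ : ∀ l A η → (l - A) - - η ≡ η - (A - l)
    flip₁ = solve-∀ ℚ-ring
    flip₂ : ∀ l A η → η - (l - A) ≡ η + (A - l)
    flip₂ = solve-∀ ℚ-ring
  near-hi : ∣ cube (hi br) - A ∣ ≤ η
  near-hi = -q≤p≤q⇒∣p∣≤q (≤-by-diff _ (flip₁ (cube (hi br)) A η) (nonNeg+ (p≤q⇒0≤q-p (A≤hi³ br)) (ℚ.<⇒≤ 0<η)))
                         (≤-by-diff _ (flip₂ (cube (lo br)) (cube (hi br)) A η)
                                    (nonNeg+ (p≤q⇒0≤q-p hi³-lo³≤η) (p≤q⇒0≤q-p (lo³≤A br))))
    where
    flip₁ : ∀ h A η → (h - A) - - η ≡ (h - A) + η
    flip₁ = solve-∀ ℚ-ring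
    flip₂ : ∀ l h A η → η - (h - A) ≡ (η - (h - l)) + (A - l)
    flip₂ = solve-∀ ℚ-ring
  q≤lo : q ≤ lo br
  q≤lo = ℚ.<⇒≤ (cube-cancel-< (<-by-diff _ (split (cube q) (cube (lo br)) A η)
           (pos+ (pos* (p<q⇒0<q-p q³<A) (ℚ.positive⁻¹ ½)) (nonNeg+ (p≤q⇒0≤q-p η≤gap) (p≤q⇒0≤q-p A-lo³≤η)))))
    where
    split : ∀ c l A η → l - c ≡ (A - c) * ½ + (((A - c) * ½ - η) + (η - (A - l)))
    split = solve-∀ ℚ-ring

-- The estimate at b = α

approximation-perturb : ∀ {s e y z y′ z′ δ} → 0ℚ ≤ s → 0ℚ < z → e ≤ ½ → ∣ y - s * z ∣ ≤ e * z →
  ∣ y′ - y ∣ ≤ δ → ∣ z′ - z ∣ ≤ δ → (1ℚ + s) * δ ≤ e * z →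
  0ℚ < z′ × ∣ y′ - s * z′ ∣ ≤ 4ℚ * e * z′
approximation-perturb {s} {e} {y} {z} {y′} {z′} {δ} 0≤s 0<z e≤½ ∣y-sz∣≤ez ∣Δy∣≤δ ∣Δz∣≤δ [1+s]δ≤ez = 0<z′ , approx
  where
  open ℚ.≤-Reasoning
  0≤z = ℚ.<⇒≤ 0<z
  0≤δ : 0ℚ ≤ δ
  0≤δ = ℚ.≤-trans (ℚ.0≤∣p∣ (z′ - z)) ∣Δz∣≤δ
  0≤e : 0ℚ ≤ e
  0≤e = nonNeg*⇒nonNeg 0<z (subst (0ℚ ≤_) (ℚ.*-comm e z) (ℚ.≤-trans (ℚ.0≤∣p∣ (y - s * z)) ∣y-sz∣≤ez))
  δ≤½z : δ ≤ ½ * z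
  δ≤½z = begin
    δ              ≤⟨ ≤-by-diff _ (extra s δ) (nonNeg* 0≤s 0≤δ) ⟩
    (1ℚ + s) * δ   ≤⟨ [1+s]δ≤ez ⟩
    e * z          ≤⟨ *-monoʳ-≤ 0≤z e≤½ ⟩
    ½ * z          ∎
    where
    extra : ∀ s δ → (1ℚ + s) * δ - δ ≡ s * δ
    extra = solve-∀ ℚ-ring
  z≤2z′ : z ≤ 2ℚ * z′
  z≤2z′ = ≤-by-diff _ (split z z′ δ)
    (nonNeg+ (nonNeg* (ℚ.<⇒≤ (ℚ.positive⁻¹ 2ℚ)) (p≤q⇒0≤q-p (proj₁ (∣p∣≤q⇒-q≤p≤q ∣Δz∣≤δ))))
             (nonNeg* (ℚ.<⇒≤ (ℚ.positive⁻¹ 2ℚ)) (p≤q⇒0≤q-p δ≤½z)))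
    where
    split : ∀ z z′ δ → 2ℚ * z′ - z ≡ 2ℚ * ((z′ - z) - - δ) + 2ℚ * (½ * z - δ)
    split = solve-∀ ℚ-ring
  0<z′ : 0ℚ < z′
  0<z′ = pos*⇒pos (ℚ.positive⁻¹ 2ℚ) (ℚ.<-≤-trans 0<z z≤2z′)
  approx : ∣ y′ - s * z′ ∣ ≤ 4ℚ * e * z′
  approx = begin
    ∣ y′ - s * z′ ∣                                      ≡⟨ cong ∣_∣ (split y z y′ z′ s) ⟩
    ∣ (y - s * z) + (y′ - y) - s * (z′ - z) ∣            ≤⟨ ℚ.∣p-q∣≤∣p∣+∣q∣ ((y - s * z) + (y′ - y)) (s * (z′ - z)) ⟩
    ∣ (y - s * z) + (y′ - y) ∣ + ∣ s * (z′ - z) ∣         ≤⟨ ℚ.+-mono-≤ (ℚ.∣p+q∣≤∣p∣+∣q∣ (y - s * z) (y′ - y))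
                                                             (ℚ.≤-reflexive (ℚ.∣p*q∣≡∣p∣*∣q∣ s (z′ - z))) ⟩
    ∣ y - s * z ∣ + ∣ y′ - y ∣ + ∣ s ∣ * ∣ z′ - z ∣         ≤⟨ ℚ.+-mono-≤ (ℚ.+-mono-≤ ∣y-sz∣≤ez ∣Δy∣≤δ)
                                                             (*-mono-≤ (ℚ.0≤∣p∣ s) (ℚ.0≤∣p∣ (z′ - z))
                                                                       (ℚ.≤-reflexive (ℚ.0≤p⇒∣p∣≡p 0≤s)) ∣Δz∣≤δ) ⟩
    e * z + δ + s * δ                                   ≡⟨ regroup e z s δ ⟩
    e * z + (1ℚ + s) * δ                                ≤⟨ ℚ.+-monoʳ-≤ (e * z) [1+s]δ≤ez ⟩
    e * z + e * z                                       ≡⟨ regroup′ e z ⟩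
    2ℚ * e * z                                          ≤⟨ *-monoˡ-≤ (nonNeg* (ℚ.<⇒≤ (ℚ.positive⁻¹ 2ℚ)) 0≤e) z≤2z′ ⟩
    2ℚ * e * (2ℚ * z′)                                  ≡⟨ regroup″ e z′ ⟩
    4ℚ * e * z′                                         ∎
    where
    split : ∀ y z y′ z′ s → y′ - s * z′ ≡ (y - s * z) + (y′ - y) - s * (z′ - z)
    split = solve-∀ ℚ-ring
    regroup : ∀ e z s δ → e * z + δ + s * δ ≡ e * z + (1ℚ + s) * δ
    regroup = solve-∀ ℚ-ring
    regroup′ : ∀ e z → e * z + e * z ≡ 2ℚ * e * z
    regroup′ = solve-∀ ℚ-ring
    regroup″ : ∀ e z′ → 2ℚ * e * (2ℚ * z′) ≡ 4ℚ * e * z′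
    regroup″ = solve-∀ ℚ-ring

cube-* : ∀ p q → cube (p * q) ≡ cube p * cube q
cube-* = expand
  where
  expand : ∀ p q → (p * q) * (p * q) * (p * q) ≡ (p * p * p) * (q * q * q)
  expand = solve-∀ ℚ-ring

below-cube-root : ∀ {A y z e ε} s → 0ℚ < z → ∣ y - s * z ∣ ≤ e * z → e < ε → cube s ≤ A →
  cube (y - ε * z) < A * cube z
below-cube-root {A} {y} {z} {e} {ε} s 0<z ∣y-sz∣≤ez e<ε s³≤A = begin-strict
  cube (y - ε * z)   <⟨ cube-mono-< {y - ε * z} {s * z} (<-by-diff _ (split y z s e ε)
                          (pos+ (pos* (p<q⇒0<q-p e<ε) 0<z) (p≤q⇒0≤q-p (proj₂ (∣p∣≤q⇒-q≤p≤q ∣y-sz∣≤ez))))) ⟩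
  cube (s * z)       ≡⟨ cube-* s z ⟩
  cube s * cube z    ≤⟨ *-monoʳ-≤ (ℚ.<⇒≤ (pos* (pos* 0<z 0<z) 0<z)) s³≤A ⟩
  A * cube z         ∎
  where
  open ℚ.≤-Reasoning
  split : ∀ y z s e ε → s * z - (y - ε * z) ≡ (ε - e) * z + (e * z - (y - s * z))
  split = solve-∀ ℚ-ring

above-cube-root : ∀ {A y z e ε} s → 0ℚ < z → ∣ y - s * z ∣ ≤ e * z → e < ε → A ≤ cube s →
  A * cube z < cube (y + ε * z)
above-cube-root {A} {y} {z} {e} {ε} s 0<z ∣y-sz∣≤ez e<ε A≤s³ = begin-strict
  A * cube z         ≤⟨ *-monoʳ-≤ (ℚ.<⇒≤ (pos* (pos* 0<z 0<z) 0<z)) A≤s³ ⟩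
  cube s * cube z    ≡⟨ sym (cube-* s z) ⟩
  cube (s * z)       <⟨ cube-mono-< {s * z} {y + ε * z} (<-by-diff _ (split y z s e ε)
                          (pos+ (pos* (p<q⇒0<q-p e<ε) 0<z) (p≤q⇒0≤q-p (proj₁ (∣p∣≤q⇒-q≤p≤q ∣y-sz∣≤ez))))) ⟩
  cube (y + ε * z)   ∎
  where
  open ℚ.≤-Reasoning
  split : ∀ y z s e ε → y + ε * z - s * z ≡ (ε - e) * z + ((y - s * z) - - (e * z))
  split = solve-∀ ℚ-ring

∣c₁-c₁∣≤dist : ∀ v w → ∣ c₁ v - c₁ w ∣ ≤ dist v w
∣c₁-c₁∣≤dist v w = ≤-by-diff _ (drop (∣ c₀ v - c₀ w ∣) (∣ c₁ v - c₁ w ∣) (∣ c₂ v - c₂ w ∣))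
  (nonNeg+ (ℚ.0≤∣p∣ (c₀ v - c₀ w)) (ℚ.0≤∣p∣ (c₂ v - c₂ w)))
  where
  drop : ∀ X Y Z → X + Y + Z - Y ≡ X + Z
  drop = solve-∀ ℚ-ring

∣c₂-c₂∣≤dist : ∀ v w → ∣ c₂ v - c₂ w ∣ ≤ dist v w
∣c₂-c₂∣≤dist v w = ≤-by-diff _ (drop (∣ c₀ v - c₀ w ∣) (∣ c₁ v - c₁ w ∣) (∣ c₂ v - c₂ w ∣))
  (nonNeg+ (ℚ.0≤∣p∣ (c₀ v - c₀ w)) (ℚ.0≤∣p∣ (c₁ v - c₁ w)))
  where
  drop : ∀ X Y Z → X + Y + Z - Z ≡ X + Y
  drop = solve-∀ ℚ-ring

∣p-q∣≡∣q-p∣ : ∀ p q → ∣ p - q ∣ ≡ ∣ q - p ∣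
∣p-q∣≡∣q-p∣ p q = trans (cong ∣_∣ (negate p q)) (ℚ.∣-p∣≡∣p∣ (q - p))
  where
  negate : ∀ p q → p - q ≡ - (q - p)
  negate = solve-∀ ℚ-ring

-- The slack hypothesis makes the Lipschitz error Λ ∣ s³ − A ∣ small against the error e c₂ at b = s³.
approximation-transfer : ∀ a {A s e η} m → 0ℚ ≤ s → 0ℚ ≤ A → s ≤ A → e ≤ ½ → ∣ cube s - A ∣ ≤ η → η ≤ 1ℚ →
  let w = powU a (cube s) m ; v = powU a A m ; Λ = lipschitz-constant a (1ℚ + A) m in
  0ℚ < c₂ w → ∣ c₁ w - s * c₂ w ∣ ≤ e * c₂ w → (1ℚ + A) * (1ℚ + Λ) * η ≤ e * c₂ w →
  0ℚ < c₂ v × ∣ c₁ v - s * c₂ v ∣ ≤ 4ℚ * e * c₂ v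
approximation-transfer a {A} {s} {e} {η} m 0≤s 0≤A s≤A e≤½ ∣s³-A∣≤η η≤1 0<z ∣y-sz∣≤ez slack =
  approximation-perturb {y = c₁ w} {c₂ w} {c₁ v} {c₂ v} 0≤s 0<z e≤½ ∣y-sz∣≤ez
    (ℚ.≤-trans (∣c₁-c₁∣≤dist v w) dist≤δ) (ℚ.≤-trans (∣c₂-c₂∣≤dist v w) dist≤δ) [1+s]δ≤ez
  where
  open ℚ.≤-Reasoning
  w = powU a (cube s) m
  v = powU a A m
  B = 1ℚ + A
  Λ = lipschitz-constant a B m
  0≤Λ = lipschitz-constant-nonNeg a m (nonNeg+ (ℚ.<⇒≤ 0<1) 0≤A)
  0≤η = ℚ.≤-trans (ℚ.0≤∣p∣ (cube s - A)) ∣s³-A∣≤η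
  ∣A∣≤B : ∣ A ∣ ≤ B
  ∣A∣≤B = subst (_≤ B) (sym (ℚ.0≤p⇒∣p∣≡p 0≤A)) (≤-by-diff _ (one A) (ℚ.<⇒≤ 0<1))
    where
    one : ∀ A → 1ℚ + A - A ≡ 1ℚ
    one = solve-∀ ℚ-ring
  ∣s³∣≤B : ∣ cube s ∣ ≤ B
  ∣s³∣≤B = begin
    ∣ cube s ∣                   ≡⟨ cong ∣_∣ (shift (cube s) A) ⟩
    ∣ (cube s - A) + A ∣         ≤⟨ ℚ.∣p+q∣≤∣p∣+∣q∣ (cube s - A) A ⟩
    ∣ cube s - A ∣ + ∣ A ∣        ≤⟨ ℚ.+-mono-≤ (ℚ.≤-trans ∣s³-A∣≤η η≤1) (ℚ.≤-reflexive (ℚ.0≤p⇒∣p∣≡p 0≤A)) ⟩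
    B                            ∎
    where
    shift : ∀ x A → x ≡ (x - A) + A
    shift = solve-∀ ℚ-ring
  dist≤δ : dist v w ≤ Λ * η
  dist≤δ = begin
    dist v w                      ≤⟨ dist-powU a m ∣A∣≤B ∣s³∣≤B ⟩
    Λ * ∣ A - cube s ∣             ≡⟨ cong (Λ *_) (∣p-q∣≡∣q-p∣ A (cube s)) ⟩
    Λ * ∣ cube s - A ∣             ≤⟨ *-monoˡ-≤ 0≤Λ ∣s³-A∣≤η ⟩
    Λ * η                         ∎
  [1+s]δ≤ez : (1ℚ + s) * (Λ * η) ≤ e * c₂ w
  [1+s]δ≤ez = begin
    (1ℚ + s) * (Λ * η)            ≤⟨ *-mono-≤ (nonNeg+ (ℚ.<⇒≤ 0<1) 0≤s) (nonNeg* 0≤Λ 0≤η)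
                                             (ℚ.+-monoʳ-≤ 1ℚ s≤A)
                                             (*-monoʳ-≤ 0≤η (≤-by-diff {Λ} {1ℚ + Λ} 1ℚ (one Λ) (ℚ.<⇒≤ 0<1))) ⟩
    B * ((1ℚ + Λ) * η)            ≡⟨ sym (ℚ.*-assoc B (1ℚ + Λ) η) ⟩
    B * (1ℚ + Λ) * η              ≤⟨ slack ⟩
    e * c₂ w                      ∎
    where
    one : ∀ Λ → 1ℚ + Λ - Λ ≡ 1ℚ
    one = solve-∀ ℚ-ring

record ErrorBudget (ε q : ℚ) : Set where
  field
    e      : ℚ
    0<e    : 0ℚ < e
    e≤½    : e ≤ ½
    4e<ε   : 4ℚ * e < ε
    4e<q-1 : 4ℚ * e < q - 1ℚ

error-budget : ∀ {ε q} → 0ℚ < ε → 1ℚ < q → ErrorBudget ε q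
error-budget {ε} {q} 0<ε 1<q = record
  { e      = μ * (½ * ½ * ½)
  ; 0<e    = pos* 0<μ (ℚ.positive⁻¹ (½ * ½ * ½))
  ; e≤½    = ℚ.≤-trans (*-monoʳ-≤ (ℚ.<⇒≤ (ℚ.positive⁻¹ (½ * ½ * ½))) (ℚ.p⊓q≤q (ε ⊓ (q - 1ℚ)) 1ℚ)) (ℚ.≤ᵇ⇒≤ _)
  ; 4e<ε   = ℚ.<-≤-trans 4e<μ (ℚ.≤-trans (ℚ.p⊓q≤p (ε ⊓ (q - 1ℚ)) 1ℚ) (ℚ.p⊓q≤p ε (q - 1ℚ)))
  ; 4e<q-1 = ℚ.<-≤-trans 4e<μ (ℚ.≤-trans (ℚ.p⊓q≤p (ε ⊓ (q - 1ℚ)) 1ℚ) (ℚ.p⊓q≤q ε (q - 1ℚ)))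
  }
  where
  μ = (ε ⊓ (q - 1ℚ)) ⊓ 1ℚ
  0<μ : 0ℚ < μ
  0<μ = ⊓-pos (⊓-pos 0<ε (p<q⇒0<q-p 1<q)) 0<1
  4e<μ : 4ℚ * (μ * (½ * ½ * ½)) < μ
  4e<μ = <-by-diff _ (half μ) (pos* 0<μ (ℚ.positive⁻¹ ½))
    where
    half : ∀ μ → μ - 4ℚ * (μ * (½ * ½ * ½)) ≡ μ * ½
    half = solve-∀ ℚ-ring

ratio-above-one : ∀ {y z s q d} → 0ℚ < z → ∣ y - s * z ∣ ≤ d * z → q ≤ s → d < q - 1ℚ → z < y
ratio-above-one {y} {z} {s} {q} {d} 0<z ∣y-sz∣≤dz q≤s d<q-1 = <-by-diff _ (split y z s q d)
  (pos+ (pos* (p<q⇒0<q-p d<q-1) 0<z)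
        (nonNeg+ (nonNeg* (p≤q⇒0≤q-p q≤s) (ℚ.<⇒≤ 0<z)) (p≤q⇒0≤q-p (proj₁ (∣p∣≤q⇒-q≤p≤q ∣y-sz∣≤dz)))))
  where
  split : ∀ y z s q d → y - z ≡ ((q - 1ℚ) - d) * z + ((s - q) * z + ((y - s * z) - - (d * z)))
  split = solve-∀ ℚ-ring

record ApproximatesCubeRoot (A ε : ℚ) (v : Cubic) : Set where
  field
    c₂-pos : 0ℚ < c₂ v
    c₂<c₁  : c₂ v < c₁ v
    below  : cube (c₁ v - ε * c₂ v) < A * cube (c₂ v)
    above  : A * cube (c₂ v) < cube (c₁ v + ε * c₂ v)

approximates-cube-root : ∀ a {q A ε} → 1ℚ < q → 0ℚ < L a q → cube q < A → 0ℚ < ε →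
  Σ ℕ λ N → ∀ m → N ℕ.≤ m → ApproximatesCubeRoot A ε (powU a A m)
approximates-cube-root a {q} {A} {ε} 1<q 0<L q³<A 0<ε = N , approximates
  where
  open ℚ.≤-Reasoning
  open ErrorBudget (error-budget 0<ε 1<q)
  0<q = ℚ.<-trans 0<1 1<q
  q≤A = ℚ.≤-trans (p≤cube-p (ℚ.<⇒≤ 1<q)) (ℚ.<⇒≤ q³<A)
  1≤A = ℚ.≤-trans (ℚ.<⇒≤ 1<q) q≤A
  0<A = ℚ.<-≤-trans 0<1 1≤A
  0≤A = ℚ.<⇒≤ 0<A
  N = proj₁ (uniform-estimate {a} {q} {A} {e} 0<q 0<L q≤A 0<e)
  U = proj₂ (uniform-estimate {a} {q} {A} {e} 0<q 0<L q≤A 0<e)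
  approximates : ∀ m → N ℕ.≤ m → ApproximatesCubeRoot A ε (powU a A m)
  approximates m N≤m = record
    { c₂-pos = proj₁ at-lo
    ; c₂<c₁  = ratio-above-one (proj₁ at-lo) (proj₂ at-lo) q≤lo 4e<q-1
    ; below  = below-cube-root {y = c₁ v} (lo br) (proj₁ at-lo) (proj₂ at-lo) 4e<ε (lo³≤A br)
    ; above  = above-cube-root {y = c₁ v} (hi br) (proj₁ at-lo) (proj₂ at-hi) 4e<ε (A≤hi³ br)
    }
    where
    v = powU a A m
    P = θ a q ^ m
    0<P : 0ℚ < P
    0<P = ^-pos m (θ-pos a 0<q 0<L)
    G = 6ℚ * (A * A)
    0<G : 0ℚ < G
    0<G = pos* (ℚ.positive⁻¹ 6ℚ) (pos* 0<A 0<A)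
    Λ = lipschitz-constant a (1ℚ + A) m
    D = G * ((1ℚ + A) * (1ℚ + Λ))
    0<D : 0ℚ < D
    0<D = pos* 0<G (pos* (pos+ 0<1 0≤A) (pos+ 0<1 (lipschitz-constant-nonNeg a m (nonNeg+ (ℚ.<⇒≤ 0<1) 0≤A))))
    gap = (A - cube q) * ½
    η = (1ℚ ⊓ gap) ⊓ (e * P * 1/pos D 0<D)
    0<η : 0ℚ < η
    0<η = ⊓-pos (⊓-pos 0<1 (pos* (p<q⇒0<q-p q³<A) (ℚ.positive⁻¹ ½))) (pos* (pos* 0<e 0<P) (1/pos-pos D 0<D))
    slack : ∀ s → q ≤ s → s ≤ A → (1ℚ + A) * (1ℚ + Λ) * η ≤ e * c₂ (powU a (cube s) m)
    slack s q≤s s≤A = *-cancelˡ-≤ 0<G (begin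
      G * ((1ℚ + A) * (1ℚ + Λ) * η)        ≡⟨ sym (ℚ.*-assoc G ((1ℚ + A) * (1ℚ + Λ)) η) ⟩
      D * η                                ≤⟨ *-monoˡ-≤ (ℚ.<⇒≤ 0<D) (ℚ.p⊓q≤q (1ℚ ⊓ gap) (e * P * 1/pos D 0<D)) ⟩
      D * (e * P * 1/pos D 0<D)             ≡⟨ *-1/pos-cancel D (e * P) 0<D ⟩
      e * P                                ≤⟨ *-monoˡ-≤ (ℚ.<⇒≤ 0<e) (proj₁ (U m N≤m s q≤s s≤A)) ⟩
      e * (G * c₂ (powU a (cube s) m))      ≡⟨ swap e G (c₂ (powU a (cube s) m)) ⟩
      G * (e * c₂ (powU a (cube s) m))      ∎)
      where
      swap : ∀ e G z → e * (G * z) ≡ G * (e * z)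
      swap = solve-∀ ℚ-ring
    at : ∀ s → q ≤ s → s ≤ A → ∣ cube s - A ∣ ≤ η → 0ℚ < c₂ v × ∣ c₁ v - s * c₂ v ∣ ≤ 4ℚ * e * c₂ v
    at s q≤s s≤A near = approximation-transfer a m (ℚ.≤-trans (ℚ.<⇒≤ 0<q) q≤s) 0≤A s≤A e≤½ near
      (ℚ.≤-trans (ℚ.p⊓q≤p (1ℚ ⊓ gap) _) (ℚ.p⊓q≤p 1ℚ gap))
      (pos*⇒pos 0<G (ℚ.<-≤-trans 0<P (proj₁ (U m N≤m s q≤s s≤A)))) (proj₂ (U m N≤m s q≤s s≤A)) (slack s q≤s s≤A)
    bracket = close-bracket 1≤A q³<A 0<η (ℚ.≤-trans (ℚ.p⊓q≤p (1ℚ ⊓ gap) _) (ℚ.p⊓q≤q 1ℚ gap))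
    br = proj₁ bracket
    q≤lo = proj₁ (proj₂ bracket)
    at-lo = at (lo br) q≤lo (ℚ.≤-trans (lo≤hi br) (hi≤A br)) (proj₁ (proj₂ (proj₂ bracket)))
    at-hi = at (hi br) (ℚ.≤-trans q≤lo (lo≤hi br)) (hi≤A br) (proj₂ (proj₂ (proj₂ bracket)))

÷-*-cancel : ∀ p q .{{_ : NonZero q}} → (p ÷ q) * q ≡ p
÷-*-cancel p q = trans (ℚ.*-assoc p (1/ q) q) (trans (cong (p *_) (ℚ.*-inverseˡ q)) (ℚ.*-identityʳ p))

module _ (α a : ℤ) (n : ℕ) where
  private
    A  = fromℤ α
    a′ = fromℤ a
    v  = powU a′ A (2 ℕ.+ n)
    y  = c₁ v
    z  = c₂ v

  aseq-gap : (A - 1ℚ) * fromℤ (aseq α a n) ≡ y - z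
  aseq-gap = aseq⁺-coefficient-gap α a (2 ℕ.+ n)

  aseq-suc-gap : (A - 1ℚ) * fromℤ (aseq α a (suc n)) ≡ (a′ - 1ℚ) * (y - z) + (A - 1ℚ) * z
  aseq-suc-gap = trans (aseq⁺-coefficient-gap α a (3 ℕ.+ n)) (split a′ A (c₀ v) y z)
    where
    split : ∀ a A x y z → (x + a * y + A * z) - (x + y + a * z) ≡ (a - 1ℚ) * (y - z) + (A - 1ℚ) * z
    split = solve-∀ ℚ-ring

  denom-gap : ∀ h₁ → denom α a n h₁ * (y - z) ≡ (A - 1ℚ) * z
  denom-gap h₁ = begin
    (r - a′ + 1ℚ) * (y - z)
      ≡⟨ cong ((r - a′ + 1ℚ) *_) (sym aseq-gap) ⟩
    (r - a′ + 1ℚ) * ((A - 1ℚ) * aₙ)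
      ≡⟨ expand r a′ A aₙ ⟩
    (A - 1ℚ) * (r * aₙ) - (a′ - 1ℚ) * ((A - 1ℚ) * aₙ)
      ≡⟨ cong₂ (λ u w → (A - 1ℚ) * u - (a′ - 1ℚ) * w) (÷-*-cancel _ aₙ) aseq-gap ⟩
    (A - 1ℚ) * fromℤ (aseq α a (suc n)) - (a′ - 1ℚ) * (y - z)
      ≡⟨ cong (_- (a′ - 1ℚ) * (y - z)) aseq-suc-gap ⟩
    (a′ - 1ℚ) * (y - z) + (A - 1ℚ) * z - (a′ - 1ℚ) * (y - z)
      ≡⟨ cancel ((a′ - 1ℚ) * (y - z)) ((A - 1ℚ) * z) ⟩
    (A - 1ℚ) * z ∎
    where
    open ≡-Reasoning
    instance _ = ≢-nonZero h₁
    aₙ = fromℤ (aseq α a n)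
    r = ratio α a n h₁
    expand : ∀ r a A x → (r - a + 1ℚ) * ((A - 1ℚ) * x) ≡ (A - 1ℚ) * (r * x) - (a - 1ℚ) * ((A - 1ℚ) * x)
    expand = solve-∀ ℚ-ring
    cancel : ∀ p q → p + q - p ≡ q
    cancel = solve-∀ ℚ-ring

  xseq-c₂ : ∀ h₁ h₂ → xseq α a n h₁ h₂ * z ≡ y
  xseq-c₂ h₁ h₂ = begin
    (1ℚ + (A - 1ℚ) ÷ d) * z            ≡⟨ regroup z (A - 1ℚ) (1/ d) ⟩
    z + (A - 1ℚ) * z * 1/ d            ≡⟨ cong (λ w → z + w * 1/ d) (sym (denom-gap h₁)) ⟩
    z + d * (y - z) * 1/ d             ≡⟨ cong (_+_ z) (cancel d (y - z)) ⟩
    z + (y - z)                        ≡⟨ restore y z ⟩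
    y                                  ∎
    where
    open ≡-Reasoning
    d = denom α a n h₁
    instance _ = ≢-nonZero h₂
    regroup : ∀ z e i → (1ℚ + e * i) * z ≡ z + e * z * i
    regroup = solve-∀ ℚ-ring
    cancel : ∀ d .{{_ : NonZero d}} w → d * w * 1/ d ≡ w
    cancel d w = trans (ℚ.*-assoc d w (1/ d)) (trans (cong (d *_) (ℚ.*-comm w (1/ d)))
                   (trans (sym (ℚ.*-assoc d (1/ d) w)) (trans (cong (_* w) (ℚ.*-inverseʳ d)) (ℚ.*-identityˡ w))))
    restore : ∀ y z → z + (y - z) ≡ y
    restore = solve-∀ ℚ-ring

  converges-at : 0ℚ < A - 1ℚ → ∀ {ε} → ApproximatesCubeRoot A ε v →
    Σ (fromℤ (aseq α a n) ≢ 0ℚ) λ h₁ → Σ (denom α a n h₁ ≢ 0ℚ) λ h₂ →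
      (cube (xseq α a n h₁ h₂ - ε) < A) × (A < cube (xseq α a n h₁ h₂ + ε))
  converges-at 0<A-1 {ε} approx = h₁ , h₂ , below′ , above′
    where
    open ApproximatesCubeRoot approx
    open ℚ.≤-Reasoning
    h₁ : fromℤ (aseq α a n) ≢ 0ℚ
    h₁ aₙ≡0 = ℚ.<-irrefl (trans (sym (trans (cong ((A - 1ℚ) *_) aₙ≡0) (ℚ.*-zeroʳ (A - 1ℚ)))) (aseq-gap))
                         (p<q⇒0<q-p c₂<c₁)
    h₂ : denom α a n h₁ ≢ 0ℚ
    h₂ d≡0 = ℚ.<-irrefl (trans (sym (trans (cong (_* (y - z)) d≡0) (ℚ.*-zeroˡ (y - z)))) (denom-gap h₁))
                        (pos* 0<A-1 c₂-pos)
    x = xseq α a n h₁ h₂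
    0<z³ : 0ℚ < cube z
    0<z³ = pos* (pos* c₂-pos c₂-pos) c₂-pos
    scaled : ∀ e → (x + e) * z ≡ y + e * z
    scaled e = trans (ℚ.*-distribʳ-+ z x e) (cong (_+ e * z) (xseq-c₂ h₁ h₂))
    below′ : cube (x - ε) < A
    below′ = *-cancelʳ-< (ℚ.<⇒≤ 0<z³) (begin-strict
      cube (x - ε) * cube z        ≡⟨ sym (cube-* (x - ε) z) ⟩
      cube ((x + - ε) * z)         ≡⟨ cong cube (trans (scaled (- ε)) (cong (_+_ y) (sym (ℚ.neg-distribˡ-* ε z)))) ⟩
      cube (y - ε * z)             <⟨ below ⟩
      A * cube z                   ∎)
    above′ : A < cube (x + ε)
    above′ = *-cancelʳ-< (ℚ.<⇒≤ 0<z³) (begin-strict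
      A * cube z                   <⟨ above ⟩
      cube (y + ε * z)             ≡⟨ cong cube (sym (scaled ε)) ⟩
      cube ((x + ε) * z)           ≡⟨ cube-* (x + ε) z ⟩
      cube (x + ε) * cube z        ∎)

-- The witness q has to exceed 1, for c₂ < c₁ in the end; 9/8 ∈ (1, ∛2) can replace a smaller one.
9/8 : ℚ
9/8 = 1ℚ + ½ * ½ * ½

raise-lower-bound : ∀ a {q A} → 0ℚ < q → 0ℚ < L a q → cube q < A → 2ℚ ≤ A →
  Σ ℚ λ q′ → 1ℚ < q′ × 0ℚ < L a q′ × cube q′ < A
raise-lower-bound a {q} {A} 0<q 0<L q³<A 2≤A = q ⊔ 9/8 , 1<q′ , bounds (ℚ.⊔-sel q 9/8)
  where
  1<q′ = ℚ.<-≤-trans (toWitness {a? = 1ℚ ℚ.<? 9/8} tt) (ℚ.p≤q⊔p q 9/8)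
  bounds : (q ⊔ 9/8 ≡ q) ⊎ (q ⊔ 9/8 ≡ 9/8) → 0ℚ < L a (q ⊔ 9/8) × cube (q ⊔ 9/8) < A
  bounds (inj₁ q⊔r≡q) = subst (λ p → 0ℚ < L a p × cube p < A) (sym q⊔r≡q) (0<L , q³<A)
  bounds (inj₂ q⊔r≡r) = subst (λ p → 0ℚ < L a p × cube p < A) (sym q⊔r≡r)
    (L-pos-mono a 0<q (ℚ.p⊔q≡q⇒p≤q q⊔r≡r) 0<L , ℚ.<-≤-trans (toWitness {a? = cube 9/8 ℚ.<? 2ℚ} tt) 2≤A)

theorem2 : (α : ℤ) → + 1 ℤ.< α → (a : ℤ) → LowerBound α a → ConvergesToCbrt α a
theorem2 α (ℤ.+<+ 1<α) a (q , 0<q , q³<α , bound) ε 0<ε =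
  let q′ , 1<q′ , 0<L , q′³<α = raise-lower-bound (fromℤ a) 0<q (lower-bound⇒L-pos (fromℤ a) q bound) q³<α 2≤α
      N , approximates = approximates-cube-root (fromℤ a) 1<q′ 0<L q′³<α 0<ε
  in N , λ n N≤n → converges-at α a n 0<α-1 (approximates (2 ℕ.+ n) (ℕ.≤-trans N≤n (ℕ.m≤n+m n 2)))
  where
  2≤α : 2ℚ ≤ fromℤ α
  2≤α = fromℤ-mono-≤ (ℤ.+≤+ 1<α)
  0<α-1 = p<q⇒0<q-p (ℚ.<-≤-trans (toWitness {a? = 1ℚ ℚ.<? 2ℚ} tt) 2≤α)
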